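{- Let $P\subseteq(0,\infty)$ and $N\subseteq(-\infty,0)$ be finite sets of integers, and let $\delta$ be a positive integer with $\delta\notin -N$; moreover, assume that $\delta\neq-\sum_{n\in N}n$ if $P\neq\emptyset$. Let $m\geqslant 1$ and let $Y^+_1,\ldots,Y^+_m,Y^-_1,\ldots,Y^-_m\subseteq\mathbb{Z}$ be finite sets. Then there are orderings $\mathbf{p}$ of $P$ and $\mathbf{n}$ of $N$ such that the sequence $\overline{\mathbf{p}},\delta,\mathbf{n}$ is two-sided valid and, for all $1\leqslant j\leqslant m$, $$|\mathrm{IS}(\mathbf{p})\cap Y^+_j|\leqslant\inf_{L\in\mathbb{N}}\left(\frac{|Y^+_j|}{L}+L+4+4\sum_{i=1}^{j-1}|Y^+_i|\right)$$ and $$|\mathrm{IS}(\mathbf{n})\cap Y^-_j|\leqslant\inf_{L\in\mathbb{N}}\left(\frac{|Y^-_j|}{L}+L+4+4\sum_{i=1}^{j-1}|Y^-_i|\right).$$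
   Context: For a sequence $\mathbf{b}=b_1,\ldots,b_r$, $\mathrm{IS}(\mathbf{b}):=\{b_1+\cdots+b_j:0\leqslant j\leqslant r\}$ is its set of initial segment sums (including the empty sum $0$), and $\overline{\mathbf{b}}:=b_r,\ldots,b_1$ is its reverse. The sequence $\overline{\mathbf{p}},\delta,\mathbf{n}$ is the concatenation of $\overline{\mathbf{p}}$, the single term $\delta$, and $\mathbf{n}$. A sequence $b_1,\ldots,b_t$ is two-sided valid if $b_i+\cdots+b_j\neq 0$ for all $1\leqslant i<j\leqslant t$ with $(i,j)\neq(1,t)$. $\mathbb{N}$ denotes the positive integers. -}

module Defs where

open import Data.Nat as ℕ using (ℕ; zero; suc; _∸_)
open import Data.Integer as ℤ using (ℤ; +_; 0ℤ)
open import Data.List using (List; []; _∷_; take; drop; length; filter; reverse; _++_; [_])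
open import Data.List.Membership.DecPropositional (ℤ._≟_) using (_∈?_)
open import Data.Fin using (Fin; toℕ)
open import Data.Product using (_×_)
open import Relation.Binary.PropositionalEquality using (_≡_)
open import Relation.Nullary using (¬_)

sumℤ : List ℤ → ℤ
sumℤ []       = 0ℤ
sumℤ (x ∷ xs) = x ℤ.+ sumℤ xs

IS : List ℤ → List ℤ
IS []       = 0ℤ ∷ []
IS (b ∷ bs) = 0ℤ ∷ Data.List.map (λ s → b ℤ.+ s) (IS bs)

segSum : List ℤ → ℕ → ℕ → ℤ
segSum b i j = sumℤ (take (suc (j ∸ i)) (drop i b))

-- Two-sided valid (0-based indices): for all 0 ≤ i < j < t with (i,j) ≠ (0,t-1),
-- b_i + ⋯ + b_j ≠ 0.
TwoSidedValid : List ℤ → Set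
TwoSidedValid b = ∀ (i j : ℕ) → i ℕ.< j → j ℕ.< length b →
  ¬ (i ≡ 0 × j ≡ length b ∸ 1) → ¬ (segSum b i j ≡ 0ℤ)

-- |IS(p) ∩ Y| where Y is given as a duplicate-free list.
countIn : List ℤ → List ℤ → ℕ
countIn Y S = length (filter (_∈? S) Y)

-- ∑_{i<j} |Y i|  (i.e. the sum over 1 ≤ i ≤ j-1 in 1-based indexing)
sumℕ : List ℕ → ℕ
sumℕ []       = 0
sumℕ (x ∷ xs) = x ℕ.+ sumℕ xs

sumBefore : ∀ {m} → (Fin m → List ℤ) → Fin m → ℕ
sumBefore {m} Y j =
  sumℕ (Data.List.map (λ i → length (Y i))
    (filter (λ i → toℕ i ℕ.<? toℕ j) (Data.List.allFin m)))

-- c ≤ inf_{L ∈ ℕ⁺} (|Y|/L + L + 4 + 4S), i.e. for every L ≥ 1,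
-- c ≤ |Y|/L + L + 4 + 4S, written after multiplying by L > 0 (exact, no division).
BoundedByInf : ℕ → ℕ → ℕ → Set
BoundedByInf c y S = ∀ (L : ℕ) → 1 ℕ.≤ L →
  c ℕ.* L ℕ.≤ y ℕ.+ L ℕ.* (L ℕ.+ 4 ℕ.+ 4 ℕ.* S)

{-# OPTIONS --safe #-}
-- Put N′ = -N. Both orderings come from a walk that starts at δ, adds unused terms of P while it is
-- below 0 (or N′ is used up) and subtracts unused terms of N′ while it is above 0 (or P is used up).
-- If the walk is never at 0 before its end, the sequence reverse p, δ, n is two-sided valid: a block
-- inside p or inside n has a sum of fixed sign, and a block through δ sums to a grid value
-- δ + (p₁ + ⋯ + pᵢ) - (n′₁ + ⋯ + n′ⱼ), which is nonzero because every row or column of the grid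
-- that the walk leaves behind lies on one side of 0.
--
-- At each step all but at most three of the remaining candidates keep the walk away from two
-- explicit dead ends, and among them the next term is chosen greedily: the first Y_i containing its
-- new partial sum should have index as large as possible (or not exist), ties broken by taking the
-- largest term. Suppose a partial sum s + a lands in Y_j while at least K = L + 2 + Σ_{i<j} |Y_i|
-- terms remain. Apart from three exceptions, the remaining terms larger than a have partial sums in
-- the earlier Y_i, so there are at most Σ_{i<j} |Y_i| of them, and at least L - 1 terms smaller
-- than a give partial sums in Y_1 ∪ ⋯ ∪ Y_j between s and s + a. Each such visit therefore moves
-- the partial sums past L points of this union, so there are at most (|Y_j| + Σ_{i<j} |Y_i|) / L
-- of them, followed by fewer than K further visits.
module Submission where

open import Defs

open import Data.Nat as ℕ using (ℕ; zero; suc; z≤n; s≤s)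
import Data.Nat.Properties as ℕP
open import Data.Integer as ℤ using (ℤ; -_; 0ℤ; _+_; _-_; _<_; _≤_)
import Data.Integer.Properties as ℤP
open import Data.Integer.Tactic.RingSolver using (solve-∀)
open import Data.Nat.Tactic.RingSolver using () renaming (solve-∀ to solve-∀ℕ)
open import Data.Fin using (Fin; toℕ) renaming (zero to fzero; suc to fsuc)
open import Data.List using (List; []; _∷_; length; filter; map; _++_; take; drop; reverse; allFin; tabulate)
import Data.List.Properties as LP
open import Data.List.Relation.Unary.All using (All; []; _∷_; all?)
import Data.List.Relation.Unary.All as All
import Data.List.Relation.Unary.All.Properties as AllP
open import Data.List.Relation.Unary.Any using (here; there; any?)
open import Data.List.Relation.Unary.AllPairs using ([]; _∷_)
open import Data.List.Relation.Unary.Unique.Propositional using (Unique)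
import Data.List.Relation.Unary.Unique.Propositional.Properties as UniqueP
open import Data.List.Relation.Binary.Permutation.Propositional
  using (_↭_; ↭-refl; ↭-trans; ↭-sym; prep; swap; ↭⇒↭ₛ)
import Data.List.Relation.Binary.Permutation.Propositional as ↭
import Data.List.Relation.Binary.Permutation.Propositional.Properties as PermP
import Data.List.Relation.Binary.Permutation.Setoid.Properties as PermS
open import Data.List.Relation.Binary.Subset.Propositional using (_⊆_)
open import Data.List.Membership.Propositional using (_∈_; _∉_; find; lose)
open import Data.List.Membership.Propositional.Properties using (∈-++⁺ˡ; ∈-++⁺ʳ; ∈-++⁻; ∈-filter⁺; ∈-filter⁻; ∈-map⁺; ∈-map⁻)
open import Data.List.Membership.DecPropositional ℤ._≟_ using (_∈?_; _∉?_)
open import Data.Product using (∃; ∃₂; _×_; _,_; proj₁; proj₂)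
open import Data.Sum using (_⊎_; inj₁; inj₂; [_,_]′)
import Data.Sum
open import Data.Unit using (⊤; tt)
open import Data.Empty using (⊥; ⊥-elim)
open import Relation.Nullary using (¬_; Dec; yes; no; does)
open import Relation.Nullary.Decidable using (decidable-stable; _⊎-dec_; _×-dec_)
import Relation.Unary
open import Relation.Unary.Properties using (∁?)
open import Data.Bool using (true; false)
open import Function using (id)
open import Relation.Binary using (tri<; tri≈; tri>)
open import Relation.Binary.PropositionalEquality
  using (_≡_; _≢_; refl; sym; trans; cong; cong₂; subst; subst₂; setoid; module ≡-Reasoning)

+-cancelˡ : ∀ s {x y : ℤ} → s + x ≡ s + y → x ≡ y
+-cancelˡ s {x} {y} eq = begin
  x             ≡⟨ undo s x ⟩
  - s + (s + x) ≡⟨ cong (- s +_) eq ⟩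
  - s + (s + y) ≡⟨ undo s y ⟨
  y             ∎
  where
  open ≡-Reasoning
  undo : ∀ s x → x ≡ - s + (s + x)
  undo = solve-∀

s<s+a : ∀ s {a} → 0ℤ < a → s < s + a
s<s+a s {a} 0<a = subst (_< s + a) (ℤP.+-identityʳ s) (ℤP.+-monoʳ-< s 0<a)

neg-swap : ∀ {x y} → x ≡ - y → y ≡ - x
neg-swap {x} {y} x≡-y = trans (sym (ℤP.neg-involutive y)) (cong -_ (sym x≡-y))

+≡0⇒≡- : ∀ {x y} → x + y ≡ 0ℤ → y ≡ - x
+≡0⇒≡- {x} {y} eq = begin
  y             ≡⟨ undo x y ⟩
  - x + (x + y) ≡⟨ cong (- x +_) eq ⟩
  - x + 0ℤ      ≡⟨ ℤP.+-identityʳ (- x) ⟩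
  - x           ∎
  where
  open ≡-Reasoning
  undo : ∀ x y → y ≡ - x + (x + y)
  undo = solve-∀

sumℤ-++ : ∀ xs ys → sumℤ (xs ++ ys) ≡ sumℤ xs + sumℤ ys
sumℤ-++ []       ys = sym (ℤP.+-identityˡ (sumℤ ys))
sumℤ-++ (x ∷ xs) ys = trans (cong (x +_) (sumℤ-++ xs ys)) (sym (ℤP.+-assoc x (sumℤ xs) (sumℤ ys)))

sumℤ-nonneg : ∀ {xs} → All (0ℤ <_) xs → 0ℤ ≤ sumℤ xs
sumℤ-nonneg []          = ℤP.≤-refl
sumℤ-nonneg (0<x ∷ 0<) = ℤP.+-mono-≤ (ℤP.<⇒≤ 0<x) (sumℤ-nonneg 0<)

sumℤ-pos : ∀ {S} → All (0ℤ <_) S → S ≢ [] → 0ℤ < sumℤ S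
sumℤ-pos {[]}    _           S≢[] = ⊥-elim (S≢[] refl)
sumℤ-pos {x ∷ S} (0<x ∷ 0<S) _    = ℤP.+-mono-<-≤ 0<x (sumℤ-nonneg 0<S)

sumℤ-map-neg : ∀ xs → sumℤ (map -_ xs) ≡ - sumℤ xs
sumℤ-map-neg []       = refl
sumℤ-map-neg (x ∷ xs) = trans (cong (- x +_) (sumℤ-map-neg xs)) (sym (ℤP.neg-distrib-+ x (sumℤ xs)))

sumℤ-↭ : ∀ {xs ys} → xs ↭ ys → sumℤ xs ≡ sumℤ ys
sumℤ-↭ ↭.refl       = refl
sumℤ-↭ (prep x p)   = cong (x +_) (sumℤ-↭ p)
sumℤ-↭ (swap x y p) = trans (cong (λ s → x + (y + s)) (sumℤ-↭ p)) (swap+ x y _)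
  where
  swap+ : ∀ x y s → x + (y + s) ≡ y + (x + s)
  swap+ = solve-∀
sumℤ-↭ (↭.trans p q) = trans (sumℤ-↭ p) (sumℤ-↭ q)

remove : ℤ → List ℤ → List ℤ
remove a []       = []
remove a (x ∷ xs) with x ℤ.≟ a
... | yes _ = xs
... | no  _ = x ∷ remove a xs

remove-↭ : ∀ {a xs} → a ∈ xs → xs ↭ a ∷ remove a xs
remove-↭ {a} {x ∷ xs} a∈ with x ℤ.≟ a
... | yes refl = ↭-refl
remove-↭ {a} {x ∷ xs} (here a≡x)  | no x≢a = ⊥-elim (x≢a (sym a≡x))
remove-↭ {a} {x ∷ xs} (there a∈) | no _   = ↭-trans (prep x (remove-↭ a∈)) (swap x a ↭-refl)

∈-remove⁻ : ∀ {a b xs} → b ∈ remove a xs → b ∈ xs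
∈-remove⁻ {a} {b} {x ∷ xs} b∈ with x ℤ.≟ a
... | yes _ = there b∈
∈-remove⁻ {a} {b} {x ∷ xs} (here b≡x) | no _ = here b≡x
∈-remove⁻ {a} {b} {x ∷ xs} (there b∈) | no _ = there (∈-remove⁻ b∈)

∈-remove⁺ : ∀ {a b xs} → b ∈ xs → b ≢ a → b ∈ remove a xs
∈-remove⁺ {a} {b} {x ∷ xs} b∈ b≢a with x ℤ.≟ a
∈-remove⁺ (here refl) b≢a | yes x≡a = ⊥-elim (b≢a x≡a)
∈-remove⁺ (there b∈)  b≢a | yes _   = b∈
∈-remove⁺ (here b≡x)  b≢a | no _    = here b≡x
∈-remove⁺ (there b∈)  b≢a | no _    = there (∈-remove⁺ b∈ b≢a)

All-remove : ∀ {P : ℤ → Set} {a xs} → All P xs → All P (remove a xs)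
All-remove {P} pxs = All.tabulate (λ b∈ → All.lookup pxs (∈-remove⁻ b∈))

Unique-remove : ∀ {a xs} → Unique xs → Unique (remove a xs)
Unique-remove {a} {[]}     u        = u
Unique-remove {a} {x ∷ xs} (x∉ ∷ u) with x ℤ.≟ a
... | yes _ = u
... | no  _ = All-remove x∉ ∷ Unique-remove u

∉-remove : ∀ {a xs} → Unique xs → a ∉ remove a xs
∉-remove {a} {x ∷ xs} (x∉ ∷ u) a∈ with x ℤ.≟ a
∉-remove (x∉ ∷ u) a∈          | yes refl = All.lookup x∉ a∈ refl
∉-remove (x∉ ∷ u) (here a≡x)  | no x≢a   = x≢a (sym a≡x)
∉-remove (x∉ ∷ u) (there a∈) | no _     = ∉-remove u a∈

sumℤ-remove : ∀ {a xs} → a ∈ xs → sumℤ xs ≡ a + sumℤ (remove a xs)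
sumℤ-remove a∈ = sumℤ-↭ (remove-↭ a∈)

length-remove : ∀ {a xs} → a ∈ xs → length xs ≡ suc (length (remove a xs))
length-remove a∈ = PermP.↭-length (remove-↭ a∈)

length-remove-≢ : ∀ {b S n} → b ∈ S → length S ≢ suc n → length (remove b S) ≢ n
length-remove-≢ b∈ |S|≢ |S′|≡ = |S|≢ (trans (length-remove b∈) (cong suc |S′|≡))

remove-single : ∀ {a x} → a ∈ x ∷ [] → remove a (x ∷ []) ≡ []
remove-single {x = x} (here refl) with x ℤ.≟ x
... | yes _   = refl
... | no x≢x = ⊥-elim (x≢x refl)

Unique-↭ : ∀ {xs ys : List ℤ} → xs ↭ ys → Unique xs → Unique ys
Unique-↭ p = PermS.Unique-resp-↭ (setoid ℤ) (↭⇒↭ₛ p)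

⊆-remove : ∀ {x xs ys} → Unique (x ∷ xs) → x ∷ xs ⊆ ys → xs ⊆ remove x ys
⊆-remove (x∉ ∷ _) ⊆ys y∈ = ∈-remove⁺ (⊆ys (there y∈)) (λ y≡x → All.lookup x∉ y∈ (sym y≡x))

Unique-⊆⇒length≤ : ∀ {xs ys : List ℤ} → Unique xs → xs ⊆ ys → length xs ℕ.≤ length ys
Unique-⊆⇒length≤ {[]}         _          _    = z≤n
Unique-⊆⇒length≤ {x ∷ xs} {ys} u@(_ ∷ u′) ⊆ys = begin
  suc (length xs)            ≤⟨ s≤s (Unique-⊆⇒length≤ u′ (⊆-remove u ⊆ys)) ⟩
  suc (length (remove x ys)) ≡⟨ length-remove (⊆ys (here refl)) ⟨
  length ys                  ∎
  where open ℕP.≤-Reasoning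

sumℤ-⊆-sameLength : ∀ {xs ys} → Unique xs → xs ⊆ ys → length xs ≡ length ys → sumℤ xs ≡ sumℤ ys
sumℤ-⊆-sameLength {[]}     {[]}     _            _    _   = refl
sumℤ-⊆-sameLength {x ∷ xs} {ys}     u@(_ ∷ u′) ⊆ys |xs| = begin
  x + sumℤ xs             ≡⟨ cong (x +_) (sumℤ-⊆-sameLength u′ (⊆-remove u ⊆ys) |xs|≡) ⟩
  x + sumℤ (remove x ys)  ≡⟨ sumℤ-remove x∈ ⟨
  sumℤ ys                 ∎
  where
  open ≡-Reasoning
  x∈ : x ∈ ys
  x∈ = ⊆ys (here refl)
  |xs|≡ : length xs ≡ length (remove x ys)
  |xs|≡ = ℕP.suc-injective (trans |xs| (length-remove x∈))

∃-∉-of-longer : ∀ {xs F} → Unique xs → length F ℕ.< length xs → ∃ λ a → a ∈ xs × a ∉ F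
∃-∉-of-longer {xs} {F} u F<xs with any? (_∉? F) xs
... | yes some = find some
... | no none  = ⊥-elim (ℕP.<⇒≱ F<xs (Unique-⊆⇒length≤ u xs⊆F))
  where
  xs⊆F : xs ⊆ F
  xs⊆F {w} w∈ = decidable-stable (w ∈? F) (λ w∉ → none (lose w∈ w∉))

length-filter-∷ : ∀ {P : ℤ → Set} (P? : Relation.Unary.Decidable P) x xs →
                  length (filter P? (x ∷ xs)) ℕ.≤ suc (length (filter P? xs))
length-filter-∷ P? x xs with does (P? x)
... | true  = ℕP.≤-refl
... | false = ℕP.n≤1+n _

length-filter-∁ : ∀ {P : ℤ → Set} (P? : Relation.Unary.Decidable P) xs →
                  length (filter P? xs) ℕ.+ length (filter (∁? P?) xs) ≡ length xs
length-filter-∁ P? []       = refl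
length-filter-∁ P? (x ∷ xs) with does (P? x)
... | true  = cong suc (length-filter-∁ P? xs)
... | false = trans (ℕP.+-suc _ _) (cong suc (length-filter-∁ P? xs))

∉-pair : ∀ {a x y : ℤ} → a ≢ x → a ≢ y → a ∉ x ∷ y ∷ []
∉-pair a≢x a≢y (here a≡x)         = a≢x a≡x
∉-pair a≢x a≢y (there (here a≡y)) = a≢y a≡y

∈-pair⁻ : ∀ {v x y : ℤ} → v ∈ x ∷ y ∷ [] → v ≡ x ⊎ v ≡ y
∈-pair⁻ (here v≡x)         = inj₁ v≡x
∈-pair⁻ (there (here v≡y)) = inj₂ v≡y

length≡2 : ∀ {xs : List ℤ} → length xs ≡ 2 → ∃₂ λ x y → xs ≡ x ∷ y ∷ []
length≡2 {x ∷ y ∷ []} refl = x , y , refl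

sumℤ-pair : ∀ {S u v} → length S ≡ 2 → u ∈ S → v ∈ S → u ≢ v → sumℤ S ≡ u + v
sumℤ-pair {x ∷ y ∷ []} refl u∈ v∈ u≢v with ∈-pair⁻ u∈ | ∈-pair⁻ v∈
... | inj₁ refl | inj₁ refl = ⊥-elim (u≢v refl)
... | inj₁ refl | inj₂ refl = cong (x +_) (ℤP.+-identityʳ y)
... | inj₂ refl | inj₁ refl = trans (cong (x +_) (ℤP.+-identityʳ y)) (ℤP.+-comm x y)
... | inj₂ refl | inj₂ refl = ⊥-elim (u≢v refl)

level : ∀ {m} → (Fin m → List ℤ) → ℤ → ℕ
level {zero}  Y v = 0
level {suc m} Y v with v ∈? Y fzero
... | yes _ = 0
... | no  _ = suc (level (λ i → Y (fsuc i)) v)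

unionBefore : ∀ {m} → (Fin m → List ℤ) → Fin m → List ℤ
unionBefore Y fzero    = []
unionBefore Y (fsuc j) = Y fzero ++ unionBefore (λ i → Y (fsuc i)) j

level≤ : ∀ {m} (Y : Fin m → List ℤ) j {v} → v ∈ Y j → level Y v ℕ.≤ toℕ j
level≤ {suc m} Y j {v} v∈ with v ∈? Y fzero
... | yes _ = z≤n
level≤ {suc m} Y fzero    v∈ | no v∉ = ⊥-elim (v∉ v∈)
level≤ {suc m} Y (fsuc j) v∈ | no _  = s≤s (level≤ (λ i → Y (fsuc i)) j v∈)

level<⇒∈unionBefore : ∀ {m} (Y : Fin m → List ℤ) j {v} → level Y v ℕ.< toℕ j → v ∈ unionBefore Y j
level<⇒∈unionBefore {suc m} Y (fsuc j) {v} lv< with v ∈? Y fzero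
level<⇒∈unionBefore {suc m} Y (fsuc j) _         | yes v∈ = ∈-++⁺ˡ v∈
level<⇒∈unionBefore {suc m} Y (fsuc j) (s≤s lv<) | no _   =
  ∈-++⁺ʳ (Y fzero) (level<⇒∈unionBefore (λ i → Y (fsuc i)) j lv<)

level≤⇒∈ : ∀ {m} (Y : Fin m → List ℤ) j {v} → level Y v ℕ.≤ toℕ j → v ∈ Y j ++ unionBefore Y j
level≤⇒∈ {suc m} Y j {v} lv≤ with v ∈? Y fzero
level≤⇒∈ {suc m} Y fzero    _         | yes v∈ = ∈-++⁺ˡ v∈
level≤⇒∈ {suc m} Y (fsuc j) _         | yes v∈ = ∈-++⁺ʳ (Y (fsuc j)) (∈-++⁺ˡ v∈)
level≤⇒∈ {suc m} Y (fsuc j) (s≤s lv≤) | no _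
  with ∈-++⁻ (Y (fsuc j)) (level≤⇒∈ (λ i → Y (fsuc i)) j lv≤)
... | inj₁ v∈ = ∈-++⁺ˡ v∈
... | inj₂ v∈ = ∈-++⁺ʳ (Y (fsuc j)) (∈-++⁺ʳ (Y fzero) v∈)

filter-<-map-fsuc : ∀ {m} k (is : List (Fin m)) →
  filter (λ i → toℕ i ℕ.<? suc k) (map fsuc is) ≡ map fsuc (filter (λ i → toℕ i ℕ.<? k) is)
filter-<-map-fsuc k []       = refl
filter-<-map-fsuc k (i ∷ is) with does (toℕ i ℕ.<? k)
... | true  = cong (fsuc i ∷_) (filter-<-map-fsuc k is)
... | false = filter-<-map-fsuc k is

length-unionBefore : ∀ {m} (Y : Fin m → List ℤ) j → length (unionBefore Y j) ≡ sumBefore Y j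
length-unionBefore {suc m} Y fzero =
  sym (cong (λ is → sumℕ (map (λ i → length (Y i)) is))
            (LP.filter-none (λ i → toℕ i ℕ.<? 0) {xs = tabulate fsuc} (All.tabulate (λ _ ()))))
length-unionBefore {suc m} Y (fsuc j) = begin
  length (Y fzero ++ unionBefore Y′ j)                     ≡⟨ LP.length-++ (Y fzero) ⟩
  length (Y fzero) ℕ.+ length (unionBefore Y′ j)           ≡⟨ cong (length (Y fzero) ℕ.+_) (length-unionBefore Y′ j) ⟩
  length (Y fzero) ℕ.+ sumℕ (map (λ i → length (Y′ i)) earlier) ≡⟨ cong (λ is → length (Y fzero) ℕ.+ sumℕ is) shift ⟩
  sumBefore Y (fsuc j)                                     ∎
  where
  open ≡-Reasoning
  Y′ : Fin m → List ℤ
  Y′ i = Y (fsuc i)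
  earlier : List (Fin m)
  earlier = filter (λ i → toℕ i ℕ.<? toℕ j) (allFin m)
  shift : map (λ i → length (Y′ i)) earlier
        ≡ map (λ i → length (Y i)) (filter (λ i → toℕ i ℕ.<? suc (toℕ j)) (tabulate fsuc))
  shift = begin
    map (λ i → length (Y′ i)) earlier                  ≡⟨ LP.map-∘ earlier ⟩
    map (λ i → length (Y i)) (map fsuc earlier)        ≡⟨ cong (map (λ i → length (Y i))) (sym (filter-<-map-fsuc (toℕ j) (allFin m))) ⟩
    map (λ i → length (Y i)) (filter (λ i → toℕ i ℕ.<? suc (toℕ j)) (map fsuc (allFin m)))
                                                       ≡⟨ cong (λ is → map (λ i → length (Y i)) (filter (λ i → toℕ i ℕ.<? suc (toℕ j)) is))
                                                               (LP.map-tabulate (λ i → i) fsuc) ⟩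
    map (λ i → length (Y i)) (filter (λ i → toℕ i ℕ.<? suc (toℕ j)) (tabulate fsuc)) ∎

-- Greedy orders and the potential argument

KeyLe : (ℤ → ℕ) → ℤ → ℤ → ℤ → Set
KeyLe rank s b a = rank (s + b) ℕ.< rank (s + a) ⊎ (rank (s + b) ≡ rank (s + a) × b ≤ a)

GreedyChoice : (ℤ → ℕ) → ℤ → ℤ → List ℤ → Set
GreedyChoice rank s a R = ∃ λ F → length F ℕ.≤ 3 × (∀ {b} → b ∈ R → b ∉ F → KeyLe rank s b a)

GreedyOrder : (ℤ → ℕ) → ℤ → List ℤ → Set
GreedyOrder rank s []      = ⊤
GreedyOrder rank s (a ∷ q) = GreedyChoice rank s a (a ∷ q) × GreedyOrder rank (s + a) q

partialSums : ℤ → List ℤ → List ℤ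
partialSums s []      = []
partialSums s (a ∷ q) = s + a ∷ partialSums (s + a) q

length-partialSums : ∀ s q → length (partialSums s q) ≡ length q
length-partialSums s []      = refl
length-partialSums s (a ∷ q) = cong suc (length-partialSums (s + a) q)

map-partialSums : ∀ t s q → map (λ x → t + x) (partialSums s q) ≡ partialSums (t + s) q
map-partialSums t s []      = refl
map-partialSums t s (a ∷ q) =
  cong₂ _∷_ (sym (ℤP.+-assoc t s a))
            (trans (map-partialSums t (s + a) q) (cong (λ u → partialSums u q) (sym (ℤP.+-assoc t s a))))

IS≡0∷partialSums : ∀ q → IS q ≡ 0ℤ ∷ partialSums 0ℤ q
IS≡0∷partialSums []      = refl
IS≡0∷partialSums (a ∷ q) = cong (0ℤ ∷_) (begin
  map (λ x → a + x) (IS q)                       ≡⟨ cong (map (λ x → a + x)) (IS≡0∷partialSums q) ⟩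
  a + 0ℤ ∷ map (λ x → a + x) (partialSums 0ℤ q)  ≡⟨ cong (_∷ map (λ x → a + x) (partialSums 0ℤ q)) a+0≡0+a ⟩
  0ℤ + a ∷ map (λ x → a + x) (partialSums 0ℤ q)  ≡⟨ cong (0ℤ + a ∷_) (map-partialSums a 0ℤ q) ⟩
  0ℤ + a ∷ partialSums (a + 0ℤ) q                ≡⟨ cong (λ u → 0ℤ + a ∷ partialSums u q) a+0≡0+a ⟩
  partialSums 0ℤ (a ∷ q)                         ∎)
  where
  open ≡-Reasoning
  a+0≡0+a : a + 0ℤ ≡ 0ℤ + a
  a+0≡0+a = ℤP.+-comm a 0ℤ

countIn≤count : ∀ {Y} → Unique Y → ∀ S → countIn Y S ℕ.≤ length (filter (_∈? Y) S)
countIn≤count {Y} uY S = Unique-⊆⇒length≤ (UniqueP.filter⁺ (_∈? S) uY) swapped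
  where
  swapped : filter (_∈? S) Y ⊆ filter (_∈? Y) S
  swapped y∈ = let y∈Y , y∈S = ∈-filter⁻ (_∈? S) y∈ in ∈-filter⁺ (_∈? Y) y∈S y∈Y

countAbove : ℤ → List ℤ → ℕ
countAbove s X = length (filter (λ v → s ℤ.<? v) X)

countBetween : ℤ → ℤ → List ℤ → ℕ
countBetween s t X = countAbove s (filter (λ v → v ℤ.≤? t) X)

countBetween+countAbove≤ : ∀ {s t} X → s ≤ t → countBetween s t X ℕ.+ countAbove t X ℕ.≤ countAbove s X
countBetween+countAbove≤ [] _ = z≤n
countBetween+countAbove≤ {s} {t} (x ∷ X) s≤t with x ℤ.≤? t
... | yes x≤t with t ℤ.<? x
...   | yes t<x = ⊥-elim (ℤP.<-irrefl refl (ℤP.<-≤-trans t<x x≤t))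
...   | no _ with s ℤ.<? x
...     | yes _ = s≤s (countBetween+countAbove≤ X s≤t)
...     | no _  = countBetween+countAbove≤ X s≤t
countBetween+countAbove≤ {s} {t} (x ∷ X) s≤t | no x≰t with t ℤ.<? x
...   | no t≮x = ⊥-elim (t≮x (ℤP.≰⇒> x≰t))
...   | yes t<x with s ℤ.<? x
...     | yes _  = ℕP.≤-trans (ℕP.≤-reflexive (ℕP.+-suc _ _)) (s≤s (countBetween+countAbove≤ X s≤t))
...     | no s≮x = ⊥-elim (s≮x (ℤP.≤-<-trans s≤t t<x))

countAbove-antitone : ∀ {s t} X → s ≤ t → countAbove t X ℕ.≤ countAbove s X
countAbove-antitone X s≤t = ℕP.≤-trans (ℕP.m≤n+m _ _) (countBetween+countAbove≤ X s≤t)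

-- A visit of Y j with at least K terms still to come lowers the potential Φ by L; the visits after
-- the last such one are fewer than K.
module Potential {m} (Y : Fin m → List ℤ) (j : Fin m) (L : ℕ) where

  B : List ℤ
  B = unionBefore Y j

  U : List ℤ
  U = Y j ++ B

  K : ℕ
  K = L ℕ.+ 2 ℕ.+ length B

  Φ : ℤ → ℕ
  Φ s = countAbove s U

  visits : ℤ → List ℤ → ℕ
  visits s q = length (filter (_∈? Y j) (partialSums s q))

  visits≤length : ∀ s q → visits s q ℕ.≤ length q
  visits≤length s q = ℕP.≤-trans (LP.length-filter (_∈? Y j) (partialSums s q))
                                  (ℕP.≤-reflexive (length-partialSums s q))

  L≤1+ : ∀ e lb ab → K ℕ.≤ e ℕ.+ (lb ℕ.+ ab) → e ℕ.≤ 3 → ab ℕ.≤ length B → L ℕ.≤ suc lb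
  L≤1+ e lb ab K≤ e≤3 ab≤B = ℕP.+-cancelʳ-≤ (2 ℕ.+ length B) L (suc lb) (begin
    L ℕ.+ (2 ℕ.+ length B)        ≡⟨ sym (ℕP.+-assoc L 2 (length B)) ⟩
    K                             ≤⟨ K≤ ⟩
    e ℕ.+ (lb ℕ.+ ab)             ≤⟨ ℕP.+-mono-≤ e≤3 (ℕP.+-monoʳ-≤ lb ab≤B) ⟩
    3 ℕ.+ (lb ℕ.+ length B)       ≡⟨ cong suc (sym (trans (ℕP.+-suc lb (suc (length B))) (cong suc (ℕP.+-suc lb (length B))))) ⟩
    suc lb ℕ.+ (2 ℕ.+ length B)   ∎)
    where open ℕP.≤-Reasoning

  -- The terms of q are split into the exceptions F, those above a (whose partial sums lie in the
  -- earlier blocks) and those below a (whose partial sums lie in U, between s and s + a).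
  module Split {s a q F} (a∉q : All (a ≢_) q) (uq : Unique q) (0<a : 0ℤ < a) (0<q : All (0ℤ <_) q)
               (maximal : ∀ {b} → b ∈ a ∷ q → b ∉ F → KeyLe (level Y) s b a) (s+a∈Yj : s + a ∈ Y j) where

    C below above : List ℤ
    C     = filter (∁? (_∈? F)) q
    below = filter (λ b → b ℤ.<? a) C
    above = filter (∁? (λ b → b ℤ.<? a)) C

    |q|≡ : length q ≡ length (filter (_∈? F) q) ℕ.+ (length below ℕ.+ length above)
    |q|≡ = trans (sym (length-filter-∁ (_∈? F) q))
                 (cong (length (filter (_∈? F) q) ℕ.+_) (sym (length-filter-∁ (λ b → b ℤ.<? a) C)))

    |q∩F|≤|F| : length (filter (_∈? F) q) ℕ.≤ length F
    |q∩F|≤|F| = Unique-⊆⇒length≤ (UniqueP.filter⁺ (_∈? F) uq) (λ b∈ → proj₂ (∈-filter⁻ (_∈? F) {xs = q} b∈))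

    private
      rank≤j : level Y (s + a) ℕ.≤ toℕ j
      rank≤j = level≤ Y j s+a∈Yj

      ∈C⁻ : ∀ {b} → b ∈ C → KeyLe (level Y) s b a × b ∈ q
      ∈C⁻ b∈ = let b∈q , b∉F = ∈-filter⁻ (∁? (_∈? F)) b∈ in maximal (there b∈q) b∉F , b∈q

      unique-shift : ∀ {P : ℤ → Set} (P? : Relation.Unary.Decidable P) → Unique (map (s +_) (filter P? C))
      unique-shift P? = UniqueP.map⁺ (+-cancelˡ s) (UniqueP.filter⁺ P? (UniqueP.filter⁺ _ uq))

    |above|≤|B| : length above ℕ.≤ length B
    |above|≤|B| = begin
      length above               ≡⟨ LP.length-map (s +_) above ⟨
      length (map (s +_) above)  ≤⟨ Unique-⊆⇒length≤ (unique-shift _) s+above⊆B ⟩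
      length B                   ∎
      where
      open ℕP.≤-Reasoning
      s+above⊆B : map (s +_) above ⊆ B
      s+above⊆B w∈ with ∈-map⁻ (s +_) w∈
      ... | b , b∈ , refl with ∈-filter⁻ (∁? (λ b → b ℤ.<? a)) b∈
      ...   | b∈C , b≮a with ∈C⁻ b∈C
      ...     | inj₁ lower , _       = level<⇒∈unionBefore Y j (ℕP.<-≤-trans lower rank≤j)
      ...     | inj₂ (_ , b≤a) , b∈q = ⊥-elim (b≮a (ℤP.≤∧≢⇒< b≤a (λ b≡a → All.lookup a∉q b∈q (sym b≡a))))

    window : suc (length below) ℕ.≤ countBetween s (s + a) U
    window = begin
      suc (length below)                  ≡⟨ cong suc (LP.length-map (s +_) below) ⟨
      length (s + a ∷ map (s +_) below)   ≤⟨ Unique-⊆⇒length≤ (All.tabulate distinct ∷ unique-shift _) inWindow ⟩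
      countBetween s (s + a) U            ∎
      where
      open ℕP.≤-Reasoning
      ∈below⁻ : ∀ {b} → b ∈ below → b < a × KeyLe (level Y) s b a × b ∈ q
      ∈below⁻ b∈ = let b∈C , b<a = ∈-filter⁻ (λ b → b ℤ.<? a) b∈ in b<a , ∈C⁻ b∈C
      distinct : ∀ {w} → w ∈ map (s +_) below → s + a ≢ w
      distinct w∈ eq with ∈-map⁻ (s +_) w∈
      ... | b , b∈ , refl = ℤP.<-irrefl (sym eq) (ℤP.+-monoʳ-< s (proj₁ (∈below⁻ b∈)))
      inWindow : s + a ∷ map (s +_) below ⊆ filter (λ v → s ℤ.<? v) (filter (λ v → v ℤ.≤? s + a) U)
      inWindow (here refl) = ∈-filter⁺ _ (∈-filter⁺ _ (∈-++⁺ˡ s+a∈Yj) ℤP.≤-refl) (s<s+a s 0<a)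
      inWindow (there w∈) with ∈-map⁻ (s +_) w∈
      ... | b , b∈ , refl with ∈below⁻ b∈
      ...   | b<a , key , b∈q = ∈-filter⁺ _ (∈-filter⁺ _ (level≤⇒∈ Y j rank≤) (ℤP.<⇒≤ (ℤP.+-monoʳ-< s b<a)))
                                            (s<s+a s (All.lookup 0<q b∈q))
        where
        rank≤ : level Y (s + b) ℕ.≤ toℕ j
        rank≤ = ℕP.≤-trans ([ ℕP.<⇒≤ , (λ (eq , _) → ℕP.≤-reflexive eq) ]′ key) rank≤j

  bigStep : ∀ s a q → Unique (a ∷ q) → All (0ℤ <_) (a ∷ q) → GreedyChoice (level Y) s a (a ∷ q) →
            s + a ∈ Y j → K ℕ.≤ length q → Φ (s + a) ℕ.+ L ℕ.≤ Φ s
  bigStep s a q (a∉q ∷ uq) (0<a ∷ 0<q) (F , |F|≤3 , maximal) s+a∈Yj K≤q = begin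
    Φ (s + a) ℕ.+ L                          ≤⟨ ℕP.+-monoʳ-≤ (Φ (s + a)) (ℕP.≤-trans L≤1+below window) ⟩
    Φ (s + a) ℕ.+ countBetween s (s + a) U   ≡⟨ ℕP.+-comm (Φ (s + a)) _ ⟩
    countBetween s (s + a) U ℕ.+ Φ (s + a)   ≤⟨ countBetween+countAbove≤ U (ℤP.<⇒≤ (s<s+a s 0<a)) ⟩
    Φ s                                      ∎
    where
    open ℕP.≤-Reasoning
    open Split {s} a∉q uq 0<a 0<q maximal s+a∈Yj
    L≤1+below : L ℕ.≤ suc (length below)
    L≤1+below = L≤1+ _ (length below) (length above) (subst (K ℕ.≤_) |q|≡ K≤q) (ℕP.≤-trans |q∩F|≤|F| |F|≤3) |above|≤|B|

  visits*L≤ : ∀ s q → Unique q → All (0ℤ <_) q → GreedyOrder (level Y) s q →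
              visits s q ℕ.* L ℕ.≤ Φ s ℕ.+ L ℕ.* K
  visits*L≤ s []      _            _            _                = z≤n
  visits*L≤ s (a ∷ q) u@(_ ∷ uq) pos@(0<a ∷ 0<q) (choice , order) with s + a ∈? Y j
  ... | no _ = ℕP.≤-trans (visits*L≤ (s + a) q uq 0<q order)
                          (ℕP.+-monoˡ-≤ (L ℕ.* K) (countAbove-antitone U (ℤP.<⇒≤ (s<s+a s 0<a))))
  ... | yes s+a∈ with K ℕ.≤? length q
  ...   | yes K≤q = begin
    L ℕ.+ visits (s + a) q ℕ.* L        ≤⟨ ℕP.+-monoʳ-≤ L (visits*L≤ (s + a) q uq 0<q order) ⟩
    L ℕ.+ (Φ (s + a) ℕ.+ L ℕ.* K)       ≡⟨ sym (ℕP.+-assoc L (Φ (s + a)) (L ℕ.* K)) ⟩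
    L ℕ.+ Φ (s + a) ℕ.+ L ℕ.* K         ≡⟨ cong (ℕ._+ L ℕ.* K) (ℕP.+-comm L (Φ (s + a))) ⟩
    Φ (s + a) ℕ.+ L ℕ.+ L ℕ.* K         ≤⟨ ℕP.+-monoˡ-≤ (L ℕ.* K) (bigStep s a q u pos choice s+a∈ K≤q) ⟩
    Φ s ℕ.+ L ℕ.* K                     ∎
    where open ℕP.≤-Reasoning
  ...   | no K≰q = begin
    suc (visits (s + a) q) ℕ.* L        ≤⟨ ℕP.*-monoˡ-≤ L (ℕP.≤-trans (s≤s (visits≤length (s + a) q)) (ℕP.≰⇒> K≰q)) ⟩
    K ℕ.* L                             ≡⟨ ℕP.*-comm K L ⟩
    L ℕ.* K                             ≤⟨ ℕP.m≤n+m (L ℕ.* K) (Φ s) ⟩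
    Φ s ℕ.+ L ℕ.* K                     ∎
    where open ℕP.≤-Reasoning

-- With y = |Y j| and b = |B|, the extra terms L + b are absorbed using b ≤ L b.
absorb-L+b : ∀ L y b → 1 ℕ.≤ L → L ℕ.+ (y ℕ.+ b ℕ.+ L ℕ.* (L ℕ.+ 2 ℕ.+ b)) ℕ.≤ y ℕ.+ L ℕ.* (L ℕ.+ 4 ℕ.+ 4 ℕ.* b)
absorb-L+b L y b 1≤L = begin
  L ℕ.+ (y ℕ.+ b ℕ.+ L ℕ.* (L ℕ.+ 2 ℕ.+ b))           ≡⟨ regroup L y b ⟩
  y ℕ.+ L ℕ.* (L ℕ.+ 2 ℕ.+ b) ℕ.+ (L ℕ.+ b)           ≤⟨ ℕP.+-monoʳ-≤ (y ℕ.+ L ℕ.* (L ℕ.+ 2 ℕ.+ b)) (ℕP.+-monoʳ-≤ L b≤) ⟩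
  y ℕ.+ L ℕ.* (L ℕ.+ 2 ℕ.+ b) ℕ.+ (L ℕ.+ (L ℕ.+ 3 ℕ.* (L ℕ.* b))) ≡⟨ expand L y b ⟩
  y ℕ.+ L ℕ.* (L ℕ.+ 4 ℕ.+ 4 ℕ.* b)                   ∎
  where
  open ℕP.≤-Reasoning
  regroup : ∀ L y b → L ℕ.+ (y ℕ.+ b ℕ.+ L ℕ.* (L ℕ.+ 2 ℕ.+ b)) ≡ y ℕ.+ L ℕ.* (L ℕ.+ 2 ℕ.+ b) ℕ.+ (L ℕ.+ b)
  regroup = solve-∀ℕ
  expand : ∀ L y b → y ℕ.+ L ℕ.* (L ℕ.+ 2 ℕ.+ b) ℕ.+ (L ℕ.+ (L ℕ.+ 3 ℕ.* (L ℕ.* b))) ≡ y ℕ.+ L ℕ.* (L ℕ.+ 4 ℕ.+ 4 ℕ.* b)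
  expand = solve-∀ℕ
  b≤ : b ℕ.≤ L ℕ.+ 3 ℕ.* (L ℕ.* b)
  b≤ = ℕP.≤-trans (ℕP.≤-trans (ℕP.m≤n*m b L {{ℕ.>-nonZero 1≤L}}) (ℕP.m≤n*m (L ℕ.* b) 3)) (ℕP.m≤n+m _ L)

greedy⇒BoundedByInf : ∀ {m} (Y : Fin m → List ℤ) → (∀ j → Unique (Y j)) →
  ∀ q → Unique q → All (0ℤ <_) q → GreedyOrder (level Y) 0ℤ q →
  ∀ j → BoundedByInf (countIn (Y j) (IS q)) (length (Y j)) (sumBefore Y j)
greedy⇒BoundedByInf Y uY q uq 0<q order j L 1≤L = begin
  countIn (Y j) (IS q) ℕ.* L                    ≤⟨ ℕP.*-monoˡ-≤ L count≤ ⟩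
  L ℕ.+ visits 0ℤ q ℕ.* L                       ≤⟨ ℕP.+-monoʳ-≤ L (visits*L≤ 0ℤ q uq 0<q order) ⟩
  L ℕ.+ (Φ 0ℤ ℕ.+ L ℕ.* K)                      ≤⟨ ℕP.+-monoʳ-≤ L (ℕP.+-monoˡ-≤ (L ℕ.* K) Φ≤) ⟩
  L ℕ.+ (length (Y j) ℕ.+ length B ℕ.+ L ℕ.* K) ≤⟨ absorb-L+b L (length (Y j)) (length B) 1≤L ⟩
  length (Y j) ℕ.+ L ℕ.* (L ℕ.+ 4 ℕ.+ 4 ℕ.* length B) ≡⟨ cong (λ b → length (Y j) ℕ.+ L ℕ.* (L ℕ.+ 4 ℕ.+ 4 ℕ.* b)) (length-unionBefore Y j) ⟩
  length (Y j) ℕ.+ L ℕ.* (L ℕ.+ 4 ℕ.+ 4 ℕ.* sumBefore Y j) ∎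
  where
  open ℕP.≤-Reasoning
  open Potential Y j L
  count≤ : countIn (Y j) (IS q) ℕ.≤ suc (visits 0ℤ q)
  count≤ = begin
    countIn (Y j) (IS q)                               ≤⟨ countIn≤count (uY j) (IS q) ⟩
    length (filter (_∈? Y j) (IS q))                   ≡⟨ cong (λ S → length (filter (_∈? Y j) S)) (IS≡0∷partialSums q) ⟩
    length (filter (_∈? Y j) (0ℤ ∷ partialSums 0ℤ q))  ≤⟨ length-filter-∷ (_∈? Y j) 0ℤ (partialSums 0ℤ q) ⟩
    suc (visits 0ℤ q)                                  ∎
  Φ≤ : Φ 0ℤ ℕ.≤ length (Y j) ℕ.+ length B
  Φ≤ = ℕP.≤-trans (LP.length-filter _ U) (ℕP.≤-reflexive (LP.length-++ (Y j)))

-- Prefix sums and walks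

prefix : List ℤ → ℕ → ℤ
prefix b n = sumℤ (take n b)

take-+ : ∀ i n (b : List ℤ) → take (i ℕ.+ n) b ≡ take i b ++ take n (drop i b)
take-+ zero    n b        = refl
take-+ (suc i) n []       = sym (LP.take-[] n)
take-+ (suc i) n (x ∷ b)  = cong (x ∷_) (take-+ i n b)

take-++ˡ : ∀ {n} (xs ys : List ℤ) → n ℕ.≤ length xs → take n (xs ++ ys) ≡ take n xs
take-++ˡ {zero}  xs       ys _         = refl
take-++ˡ {suc n} (x ∷ xs) ys (s≤s n≤) = cong (x ∷_) (take-++ˡ xs ys n≤)

take-++-length : ∀ (xs : List ℤ) n ys → take (length xs ℕ.+ n) (xs ++ ys) ≡ xs ++ take n ys
take-++-length []       n ys = refl
take-++-length (x ∷ xs) n ys = cong (x ∷_) (take-++-length xs n ys)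

prefix-segSum : ∀ b {i j} → i ℕ.≤ j → prefix b (suc j) ≡ prefix b i + segSum b i j
prefix-segSum b {i} {j} i≤j = begin
  sumℤ (take (suc j) b)                                  ≡⟨ cong (λ n → sumℤ (take n b)) i+len≡1+j ⟨
  sumℤ (take (i ℕ.+ suc (j ℕ.∸ i)) b)                    ≡⟨ cong sumℤ (take-+ i (suc (j ℕ.∸ i)) b) ⟩
  sumℤ (take i b ++ take (suc (j ℕ.∸ i)) (drop i b))     ≡⟨ sumℤ-++ (take i b) _ ⟩
  prefix b i + segSum b i j                              ∎
  where
  open ≡-Reasoning
  i+len≡1+j : i ℕ.+ suc (j ℕ.∸ i) ≡ suc j
  i+len≡1+j = trans (ℕP.+-suc i (j ℕ.∸ i)) (cong suc (ℕP.m+[n∸m]≡n i≤j))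

prefix-nonneg : ∀ {xs} → All (0ℤ <_) xs → ∀ n → 0ℤ ≤ prefix xs n
prefix-nonneg 0<xs n = sumℤ-nonneg (AllP.take⁺ n 0<xs)

prefix-strictMono : ∀ {xs} → All (0ℤ <_) xs → ∀ {i j} → i ℕ.< j → j ℕ.≤ length xs → prefix xs i < prefix xs j
prefix-strictMono {x ∷ xs} (0<x ∷ 0<) {zero}  {suc j} _         _         =
  ℤP.+-mono-<-≤ 0<x (prefix-nonneg 0< j)
prefix-strictMono {x ∷ xs} (0<x ∷ 0<) {suc i} {suc j} (s≤s i<j) (s≤s j≤) =
  ℤP.+-monoʳ-< x (prefix-strictMono 0< i<j j≤)

prefix-map-neg : ∀ ns n → prefix (map -_ ns) n ≡ - prefix ns n
prefix-map-neg ns n = trans (cong sumℤ (LP.take-map n ns)) (sumℤ-map-neg (take n ns))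

prefix-reverse : ∀ ps {i} → i ℕ.≤ length ps → prefix (reverse ps) i + prefix ps (length ps ℕ.∸ i) ≡ sumℤ ps
prefix-reverse ps {i} i≤ = begin
  prefix (reverse ps) i + sumℤ (take t ps)                           ≡⟨ cong (_+ sumℤ (take t ps)) front ⟩
  sumℤ (reverse (drop t ps)) + sumℤ (take t ps)                      ≡⟨ cong (_+ sumℤ (take t ps)) (sumℤ-↭ (PermP.↭-reverse (drop t ps))) ⟩
  sumℤ (drop t ps) + sumℤ (take t ps)                                ≡⟨ ℤP.+-comm (sumℤ (drop t ps)) _ ⟩
  sumℤ (take t ps) + sumℤ (drop t ps)                                ≡⟨ sumℤ-++ (take t ps) (drop t ps) ⟨
  sumℤ (take t ps ++ drop t ps)                                      ≡⟨ cong sumℤ (LP.take++drop≡id t ps) ⟩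
  sumℤ ps                                                            ∎
  where
  open ≡-Reasoning
  t : ℕ
  t = length ps ℕ.∸ i
  |rev-drop|≡i : length (reverse (drop t ps)) ≡ i
  |rev-drop|≡i = trans (LP.length-reverse (drop t ps)) (trans (LP.length-drop t ps) (ℕP.m∸[m∸n]≡n i≤))
  front : prefix (reverse ps) i ≡ sumℤ (reverse (drop t ps))
  front = begin
    sumℤ (take i (reverse ps))                                         ≡⟨ cong (λ xs → sumℤ (take i (reverse xs))) (LP.take++drop≡id t ps) ⟨
    sumℤ (take i (reverse (take t ps ++ drop t ps)))                   ≡⟨ cong (λ xs → sumℤ (take i xs)) (LP.reverse-++ (take t ps) (drop t ps)) ⟩
    sumℤ (take i (reverse (drop t ps) ++ reverse (take t ps)))         ≡⟨ cong sumℤ (take-++ˡ _ _ (ℕP.≤-reflexive (sym |rev-drop|≡i))) ⟩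
    sumℤ (take i (reverse (drop t ps)))                                ≡⟨ cong sumℤ (LP.take-all i _ (ℕP.≤-reflexive |rev-drop|≡i)) ⟩
    sumℤ (reverse (drop t ps))                                         ∎

DistinctPrefixes : List ℤ → Set
DistinctPrefixes b = ∀ {i j} → i ℕ.< j → j ℕ.≤ length b → ¬ (i ≡ 0 × j ≡ length b) → prefix b i ≢ prefix b j

DistinctPrefixes⇒TwoSidedValid : ∀ {b} → DistinctPrefixes b → TwoSidedValid b
DistinctPrefixes⇒TwoSidedValid {b} distinct i j i<j j<len notEnds seg≡0 =
  distinct (s≤s (ℕP.<⇒≤ i<j)) j<len (λ (i≡0 , 1+j≡len) → notEnds (i≡0 , cong (ℕ._∸ 1) 1+j≡len)) (begin
    prefix b i                ≡⟨ ℤP.+-identityʳ (prefix b i) ⟨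
    prefix b i + 0ℤ           ≡⟨ cong (prefix b i +_) seg≡0 ⟨
    prefix b i + segSum b i j ≡⟨ prefix-segSum b (ℕP.<⇒≤ i<j) ⟨
    prefix b (suc j)          ∎)
  where open ≡-Reasoning

data Position (k : ℕ) : ℕ → Set where
  left  : ∀ {i} → i ℕ.≤ k → Position k i
  right : ∀ u → Position k (k ℕ.+ suc u)

position : ∀ k i → Position k i
position zero    zero    = left z≤n
position zero    (suc i) = right i
position (suc k) zero    = left z≤n
position (suc k) (suc i) with position k i
... | left i≤k = left (s≤s i≤k)
... | right u  = right u

data Walk : ℤ → List ℤ → List ℤ → Set where
  done : ∀ {f} → Walk f [] []
  up   : ∀ {f a ps ns} → f ≢ 0ℤ → f < 0ℤ ⊎ ns ≡ [] → Walk (f + a) ps ns → Walk f (a ∷ ps) ns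
  down : ∀ {f b ps ns} → f ≢ 0ℤ → 0ℤ < f ⊎ ps ≡ [] → Walk (f - b) ps ns → Walk f ps (b ∷ ns)

mirror : ∀ {f ps ns} → Walk f ps ns → Walk (- f) ns ps
mirror done = done
mirror {f} (up {a = a} f≢0 side w) =
  down (λ -f≡0 → f≢0 (neg-swap (sym -f≡0))) (Data.Sum.map ℤP.neg-mono-< id side)
       (subst (λ g → Walk g _ _) (-[f+a] f a) (mirror w))
  where
  -[f+a] : ∀ f a → - (f + a) ≡ - f - a
  -[f+a] = solve-∀
mirror {f} (down {b = b} f≢0 side w) =
  up (λ -f≡0 → f≢0 (neg-swap (sym -f≡0))) (Data.Sum.map ℤP.neg-mono-< id side)
     (subst (λ g → Walk g _ _) (-[f-b] f b) (mirror w))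
  where
  -[f-b] : ∀ f b → - (f - b) ≡ - f + b
  -[f-b] = solve-∀

AvoidsZero : ℤ → List ℤ → List ℤ → Set
AvoidsZero f ps ns = ∀ {i j} → i ℕ.≤ length ps → j ℕ.≤ length ns → ¬ (i ≡ length ps × j ≡ length ns) →
  f + prefix ps i - prefix ns j ≢ 0ℤ

-- A step up from f < 0 leaves behind the row f - prefix ns j, which is negative throughout;
-- symmetrically for steps down.
walk⇒AvoidsZero : ∀ {f ps ns} → Walk f ps ns → All (0ℤ <_) ps → All (0ℤ <_) ns → AvoidsZero f ps ns
walk⇒AvoidsZero done _ _ z≤n z≤n notEnds _ = notEnds (refl , refl)
walk⇒AvoidsZero {f} (up f≢0 (inj₁ f<0) w) _ 0<ns {zero} {j} _ _ _ =
  ℤP.<⇒≢ (ℤP.+-mono-<-≤ (subst (_< 0ℤ) (sym (ℤP.+-identityʳ f)) f<0) (ℤP.neg-mono-≤ (prefix-nonneg 0<ns j)))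
walk⇒AvoidsZero {f} (up f≢0 (inj₂ refl) w) _ _ {zero} _ z≤n _ eq =
  f≢0 (trans (sym (trans (ℤP.+-identityʳ (f + 0ℤ)) (ℤP.+-identityʳ f))) eq)
walk⇒AvoidsZero {f} (up {a = a} {ps} {ns} _ _ w) (_ ∷ 0<ps) 0<ns {suc i} {j} (s≤s i≤) j≤ notEnds eq =
  walk⇒AvoidsZero w 0<ps 0<ns i≤ j≤ (λ (i≡ , j≡) → notEnds (cong suc i≡ , j≡))
    (trans (reassoc f a (prefix ps i) (prefix ns j)) eq)
  where
  reassoc : ∀ f a p n → f + a + p - n ≡ f + (a + p) - n
  reassoc = solve-∀
walk⇒AvoidsZero {f} (down f≢0 (inj₁ 0<f) w) 0<ps _ {i} {zero} _ _ _ eq =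
  ℤP.<⇒≢ (ℤP.<-≤-trans 0<f f≤) (sym eq)
  where
  f≤ : f ≤ f + prefix _ i - 0ℤ
  f≤ = subst₂ _≤_ (ℤP.+-identityʳ f) (sym (ℤP.+-identityʳ _)) (ℤP.+-monoʳ-≤ f (prefix-nonneg 0<ps i))
walk⇒AvoidsZero {f} (down f≢0 (inj₂ refl) w) _ _ {zero} {zero} _ _ _ eq =
  f≢0 (trans (sym (trans (ℤP.+-identityʳ (f + 0ℤ)) (ℤP.+-identityʳ f))) eq)
walk⇒AvoidsZero {f} (down {b = b} {ps} {ns} _ _ w) 0<ps (_ ∷ 0<ns) {i} {suc j} i≤ (s≤s j≤) notEnds eq =
  walk⇒AvoidsZero w 0<ps 0<ns i≤ j≤ (λ (i≡ , j≡) → notEnds (i≡ , cong suc j≡))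
    (trans (reassoc f b (prefix ps i) (prefix ns j)) eq)
  where
  reassoc : ∀ f b p n → f - b + p - n ≡ f + p - (b + n)
  reassoc = solve-∀

module _ {δ : ℤ} {ps ns : List ℤ} where

  private
    xs b : List ℤ
    xs = reverse ps
    b  = xs ++ δ ∷ map -_ ns
    k : ℕ
    k = length xs
    |b| : length b ≡ k ℕ.+ suc (length ns)
    |b| = trans (LP.length-++ xs) (cong (λ n → k ℕ.+ suc n) (LP.length-map -_ ns))
    prefix-left : ∀ {n} → n ℕ.≤ k → prefix b n ≡ prefix xs n
    prefix-left n≤k = cong sumℤ (take-++ˡ xs _ n≤k)
    prefix-right : ∀ u → prefix b (k ℕ.+ suc u) ≡ sumℤ xs + (δ + prefix (map -_ ns) u)
    prefix-right u = trans (cong sumℤ (take-++-length xs (suc u) _)) (sumℤ-++ xs _)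
    u≤|ns| : ∀ u → k ℕ.+ suc u ℕ.≤ length b → u ℕ.≤ length ns
    u≤|ns| u ≤len = ℕ.s≤s⁻¹ (ℕP.+-cancelˡ-≤ k (suc u) (suc (length ns)) (subst (k ℕ.+ suc u ℕ.≤_) |b| ≤len))

  AvoidsZero⇒DistinctPrefixes : All (0ℤ <_) ps → All (0ℤ <_) ns → AvoidsZero δ ps ns →
    DistinctPrefixes (reverse ps ++ δ ∷ map -_ ns)
  AvoidsZero⇒DistinctPrefixes 0<ps 0<ns avoids {i} {j} i<j j≤len notEnds eq with position k j
  ... | left j≤k = ℤP.<⇒≢ (prefix-strictMono 0<xs i<j j≤k)
                          (trans (sym (prefix-left (ℕP.<⇒≤ (ℕP.<-≤-trans i<j j≤k)))) (trans eq (prefix-left j≤k)))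
    where
    0<xs : All (0ℤ <_) xs
    0<xs = PermP.All-resp-↭ (↭-sym (PermP.↭-reverse ps)) 0<ps
  ... | right u with position k i
  ...   | left i≤k = avoids (ℕP.m∸n≤m (length ps) i) u≤ notEnds′ (begin
    δ + prefix ps t - prefix ns u                        ≡⟨ split (prefix xs i) (prefix ps t) δ (prefix ns u) (sumℤ ps) ⟩
    (prefix xs i + prefix ps t - sumℤ ps) + (sumℤ ps + (δ + - prefix ns u) - prefix xs i)
                                                         ≡⟨ cong₂ _+_ (cong (_- sumℤ ps) (prefix-reverse ps i≤|ps|)) (cong (_- prefix xs i) (sym eq′)) ⟩
    (sumℤ ps - sumℤ ps) + (prefix xs i - prefix xs i)    ≡⟨ cong₂ _+_ (ℤP.+-inverseʳ (sumℤ ps)) (ℤP.+-inverseʳ (prefix xs i)) ⟩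
    0ℤ                                                   ∎)
    where
    open ≡-Reasoning
    t : ℕ
    t = length ps ℕ.∸ i
    i≤|ps| : i ℕ.≤ length ps
    i≤|ps| = subst (i ℕ.≤_) (LP.length-reverse ps) i≤k
    u≤ : u ℕ.≤ length ns
    u≤ = u≤|ns| u j≤len
    split : ∀ a p d n S → d + p - n ≡ (a + p - S) + (S + (d + - n) - a)
    split = solve-∀
    eq′ : prefix xs i ≡ sumℤ ps + (δ + - prefix ns u)
    eq′ = trans (sym (prefix-left i≤k)) (trans eq (trans (prefix-right u) (cong₂ (λ S p → S + (δ + p)) (sumℤ-↭ (PermP.↭-reverse ps)) (prefix-map-neg ns u))))
    notEnds′ : ¬ (t ≡ length ps × u ≡ length ns)
    notEnds′ (t≡ , u≡) = notEnds (i≡0 , trans (cong (λ n → k ℕ.+ suc n) u≡) (sym |b|))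
      where
      i≡0 : i ≡ 0
      i≡0 = trans (sym (ℕP.m∸[m∸n]≡n i≤|ps|)) (trans (cong (length ps ℕ.∸_) t≡) (ℕP.n∸n≡0 (length ps)))
  ...   | right u′ = ℤP.<⇒≢ (prefix-strictMono 0<ns u′<u (u≤|ns| u j≤len))
                            (ℤP.neg-injective (trans (sym (prefix-map-neg ns u′)) (trans (cancel eq) (prefix-map-neg ns u))))
    where
    u′<u : u′ ℕ.< u
    u′<u = ℕ.s≤s⁻¹ (ℕP.+-cancelˡ-< k (suc u′) (suc u) i<j)
    cancel : prefix b (k ℕ.+ suc u′) ≡ prefix b (k ℕ.+ suc u) → prefix (map -_ ns) u′ ≡ prefix (map -_ ns) u
    cancel e = +-cancelˡ δ (+-cancelˡ (sumℤ xs) (trans (sym (prefix-right u′)) (trans e (prefix-right u))))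

walk⇒TwoSidedValid : ∀ {δ ps ns} → All (0ℤ <_) ps → All (0ℤ <_) ns → Walk δ ps ns →
  TwoSidedValid (reverse ps ++ δ ∷ map -_ ns)
walk⇒TwoSidedValid 0<ps 0<ns w =
  DistinctPrefixes⇒TwoSidedValid (AvoidsZero⇒DistinctPrefixes 0<ps 0<ns (walk⇒AvoidsZero w 0<ps 0<ns))

-- Moves that keep the walk alive

AllButAtMost3 : List ℤ → (ℤ → Set) → Set
AllButAtMost3 C P = ∃ λ F → length F ℕ.≤ 3 × (∃ λ a → a ∈ C × a ∉ F) × (∀ {a} → a ∈ C → a ∉ F → P a)

allButAtMost3-byCounting : ∀ {C P} F → Unique C → length F ℕ.< length C → length F ℕ.≤ 3 →
  (∀ {a} → a ∈ C → a ∉ F → P a) → AllButAtMost3 C P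
allButAtMost3-byCounting F uC F<C F≤3 good = F , F≤3 , ∃-∉-of-longer uC F<C , good

-- D = δ + ΣP - ΣN is the value at which the walk ends; mirroring makes it nonnegative.
module Moves (D : ℤ) (0≤D : 0ℤ ≤ D) where

  record Balanced (f : ℤ) (R S : List ℤ) : Set where
    constructor balanced
    field
      uniqueR : Unique R
      uniqueS : Unique S
      0<R     : All (0ℤ <_) R
      0<S     : All (0ℤ <_) S
      balance : f + sumℤ R - sumℤ S ≡ D

  open Balanced public

  Balanced-up : ∀ {f R S a} → Balanced f R S → a ∈ R → Balanced (f + a) (remove a R) S
  Balanced-up {f} {R} {S} {a} (balanced uR uS 0<R 0<S bal) a∈ =
    balanced (Unique-remove uR) uS (All-remove 0<R) 0<S (begin
      f + a + sumℤ (remove a R) - sumℤ S   ≡⟨ reassoc f a _ _ ⟩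
      f + (a + sumℤ (remove a R)) - sumℤ S ≡⟨ cong (λ r → f + r - sumℤ S) (sumℤ-remove a∈) ⟨
      f + sumℤ R - sumℤ S                  ≡⟨ bal ⟩
      D                                    ∎)
    where
    open ≡-Reasoning
    reassoc : ∀ f a r s → f + a + r - s ≡ f + (a + r) - s
    reassoc = solve-∀

  Balanced-down : ∀ {f R S b} → Balanced f R S → b ∈ S → Balanced (f - b) R (remove b S)
  Balanced-down {f} {R} {S} {b} (balanced uR uS 0<R 0<S bal) b∈ =
    balanced uR (Unique-remove uS) 0<R (All-remove 0<S) (begin
      f - b + sumℤ R - sumℤ (remove b S)   ≡⟨ reassoc f b _ _ ⟩
      f + sumℤ R - (b + sumℤ (remove b S)) ≡⟨ cong (λ s → f + sumℤ R - s) (sumℤ-remove b∈) ⟨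
      f + sumℤ R - sumℤ S                  ≡⟨ bal ⟩
      D                                    ∎)
    where
    open ≡-Reasoning
    reassoc : ∀ f b r s → f - b + r - s ≡ f + r - (b + s)
    reassoc = solve-∀

  -- The two states from which every continuation returns to 0 too early. In the first, R = {D, c}
  -- and f = -D, so adding D gives 0 and adding c leaves R = {D} with sum D. In the second, f > 0 must
  -- step down, and subtracting f gives 0 while subtracting f + D gives the first.
  DeadEnd₁ : ℤ → List ℤ → Set
  DeadEnd₁ f R = f ≡ - D × D ∈ R × length R ≡ 2

  DeadEnd₂ : ℤ → List ℤ → List ℤ → Set
  DeadEnd₂ f R S = D ∈ R × length R ≡ 2 × length S ≡ 2 × f ∈ S × f + D ∈ S

  -- Once S is used up the walk sits at D - ΣR, hence the condition ΣR ≢ D.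
  record Live (f : ℤ) (R S : List ℤ) : Set where
    constructor live
    field
      f≢0    : f ≢ 0ℤ
      ΣR≢D   : R ≢ [] → sumℤ R ≢ D
      ¬dead₁ : ¬ DeadEnd₁ f R
      ¬dead₂ : ¬ DeadEnd₂ f R S

  open Live public

  Good : ℤ → List ℤ → List ℤ → Set
  Good f R S = (R ≡ [] × S ≡ []) ⊎ Live f R S

  UpMove : ℤ → List ℤ → List ℤ → Set
  UpMove f R S = AllButAtMost3 R (λ a → Good (f + a) (remove a R) S)

  DownMove : ℤ → List ℤ → List ℤ → Set
  DownMove f R S = AllButAtMost3 S (λ b → Good (f - b) R (remove b S))

  pairWithD : ∀ {R} → Unique R → length R ≡ 2 → D ∈ R → ∃ λ c → c ∈ R × c ≢ D × sumℤ R ≡ D + c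
  pairWithD {x ∷ y ∷ []} ((x≢y ∷ []) ∷ _) refl D∈ with ∈-pair⁻ D∈
  ... | inj₁ refl = y , there (here refl) , (λ y≡x → x≢y (sym y≡x)) , cong (x +_) (ℤP.+-identityʳ y)
  ... | inj₂ refl = x , here refl , x≢y , trans (cong (x +_) (ℤP.+-identityʳ y)) (ℤP.+-comm x y)

  dead₂⇒partner : ∀ {g R S c} → Balanced g R S → DeadEnd₂ g R S → sumℤ R ≡ D + c → c ≡ D + g
  dead₂⇒partner {g} {R} {S} {c} I (D∈ , _ , |S|≡2 , g∈ , g+D∈) ΣR≡ = begin
    c                                         ≡⟨ solve D c g ⟩
    g + (D + c) - (g + (g + D)) + g           ≡⟨ cong₂ (λ r s → g + r - s + g) (sym ΣR≡) (sym ΣS≡) ⟩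
    g + sumℤ R - sumℤ S + g                   ≡⟨ cong (_+ g) (balance I) ⟩
    D + g                                     ∎
    where
    open ≡-Reasoning
    solve : ∀ D c g → c ≡ g + (D + c) - (g + (g + D)) + g
    solve = solve-∀
    ΣS≡ : sumℤ S ≡ g + (g + D)
    ΣS≡ = sumℤ-pair |S|≡2 g∈ g+D∈ (ℤP.<⇒≢ (s<s+a g (All.lookup (0<R I) D∈)))

  Live-emptyR : ∀ {g S} → Balanced g [] S → S ≢ [] → Live g [] S
  Live-emptyR {g} {S} I S≢[] = live (λ g≡0 → ℤP.<⇒≢ 0<g (sym g≡0)) (λ []≢[] → ⊥-elim ([]≢[] refl))
                                   (λ ()) (λ ())
    where
    g≡D+ΣS : g ≡ D + sumℤ S
    g≡D+ΣS = trans (move g (sumℤ S)) (cong (_+ sumℤ S) (balance I))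
      where
      move : ∀ g s → g ≡ g + 0ℤ - s + s
      move = solve-∀
    0<g : 0ℤ < g
    0<g = subst (0ℤ <_) (sym g≡D+ΣS) (ℤP.+-mono-≤-< 0≤D (sumℤ-pos (0<S I) S≢[]))

  Good-emptyR : ∀ {g R S} → Balanced g R S → R ≡ [] → Good g R S
  Good-emptyR {S = []}    _ refl = inj₁ (refl , refl)
  Good-emptyR {S = _ ∷ _} I refl = inj₂ (Live-emptyR I (λ ()))

  live-up : ∀ {f R S a} → Balanced f R S → a ∈ R → a ∉ - f ∷ sumℤ R - D ∷ [] →
            ¬ (D ∈ remove a R × length (remove a R) ≡ 2) → Live (f + a) (remove a R) S
  live-up {f} {R} {a = a} I a∈ a∉F noPair =
    live (λ f+a≡0 → a∉F (here (+≡0⇒≡- f+a≡0))) ΣR′≢D (λ (_ , D∈ , len) → noPair (D∈ , len))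
         (λ (D∈ , len , _) → noPair (D∈ , len))
    where
    ΣR′≢D : remove a R ≢ [] → sumℤ (remove a R) ≢ D
    ΣR′≢D _ ΣR′≡D = a∉F (there (here (begin
      a                          ≡⟨ solve a D ⟩
      a + D - D                  ≡⟨ cong (λ r → a + r - D) ΣR′≡D ⟨
      a + sumℤ (remove a R) - D  ≡⟨ cong (_- D) (sumℤ-remove a∈) ⟨
      sumℤ R - D                 ∎)))
      where
      open ≡-Reasoning
      solve : ∀ a D → a ≡ a + D - D
      solve = solve-∀

  upMove-single : ∀ {f x S} → Balanced f (x ∷ []) S → UpMove f (x ∷ []) S
  upMove-single {x = x} I =
    [] , z≤n , (x , here refl , λ ()) , λ a∈ _ → Good-emptyR (Balanced-up I a∈) (remove-single a∈)

  upMove-pair : ∀ {f x y S} → Balanced f (x ∷ y ∷ []) S → Live f (x ∷ y ∷ []) S → UpMove f (x ∷ y ∷ []) S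
  upMove-pair {f} {x} {y} {S} I L = F , s≤s (s≤s z≤n) , witness (D ∈? R) , good
    where
    R F : List ℤ
    R = x ∷ y ∷ []
    F = - f ∷ sumℤ R - D ∷ []
    x≢y : x ≢ y
    x≢y with uniqueR I
    ... | (x≢y ∷ []) ∷ _ = x≢y
    good : ∀ {a} → a ∈ R → a ∉ F → Good (f + a) (remove a R) S
    good a∈ a∉F = inj₂ (live-up I a∈ a∉F (λ (_ , |R′|≡2) → length-remove-≢ a∈ (λ ()) |R′|≡2))
    other≡D : ∀ {u v} → u ≡ u + (v + 0ℤ) - D → D ≡ v
    other≡D {u} {v} e = trans (solve D u v) (trans (cong (λ w → u + (v + 0ℤ) - w) (sym e)) (cancel u v))
      where
      solve : ∀ D u v → D ≡ u + (v + 0ℤ) - (u + (v + 0ℤ) - D)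
      solve = solve-∀
      cancel : ∀ u v → u + (v + 0ℤ) - u ≡ v
      cancel = solve-∀
    witness : Dec (D ∈ R) → ∃ λ a → a ∈ R × a ∉ F
    witness (yes D∈) = D , D∈ , ∉-pair D≢-f D≢ΣR-D
      where
      D≢-f : D ≢ - f
      D≢-f D≡-f = ¬dead₁ L (neg-swap D≡-f , D∈ , refl)
      D≢ΣR-D : D ≢ sumℤ R - D
      D≢ΣR-D D≡ with pairWithD (uniqueR I) refl D∈
      ... | c , _ , c≢D , ΣR≡D+c = c≢D (sym (trans D≡ (trans (cong (_- D) ΣR≡D+c) (solve D c))))
        where
        solve : ∀ D c → D + c - D ≡ c
        solve = solve-∀
    witness (no D∉) with x ℤ.≟ - f
    ... | no x≢-f  = x , here refl , ∉-pair x≢-f (λ x≡ → D∉ (there (here (other≡D x≡))))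
    ... | yes x≡-f = y , there (here refl) ,
                     ∉-pair (λ y≡-f → x≢y (trans x≡-f (sym y≡-f)))
                            (λ y≡ → D∉ (here (other≡D (trans y≡ (cong (_- D) (comm x y))))))
      where
      comm : ∀ x y → x + (y + 0ℤ) ≡ y + (x + 0ℤ)
      comm = solve-∀

  upMove-generic : ∀ {f R S} → Balanced f R S → 3 ℕ.≤ length R → (length R ≡ 3 → D ∉ R) → UpMove f R S
  upMove-generic {f} {R} I 3≤|R| |R|≡3⇒D∉ =
    allButAtMost3-byCounting (- f ∷ sumℤ R - D ∷ []) (uniqueR I) 3≤|R| (s≤s (s≤s z≤n)) good
    where
    good : ∀ {a} → a ∈ R → a ∉ - f ∷ sumℤ R - D ∷ [] → Good (f + a) (remove a R) _
    good a∈ a∉F = inj₂ (live-up I a∈ a∉F λ (D∈ , |R′|≡2) →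
      |R|≡3⇒D∉ (trans (length-remove a∈) (cong suc |R′|≡2)) (∈-remove⁻ D∈))

  record TripleWithD (R : List ℤ) (a₁ a₂ : ℤ) : Set where
    field
      D∈R    : D ∈ R
      a₁∈R   : a₁ ∈ R
      a₂∈R   : a₂ ∈ R
      a₁≢D   : a₁ ≢ D
      a₂≢D   : a₂ ≢ D
      a₁≢a₂  : a₁ ≢ a₂
      others : ∀ {a} → a ∈ R → a ≢ D → a ≡ a₁ ⊎ a ≡ a₂
      ΣR≡    : sumℤ R ≡ D + (a₁ + a₂)

  tripleWithD : ∀ {R} → Unique R → D ∈ R → length R ≡ 3 → ∃₂ (TripleWithD R)
  tripleWithD {R} uR D∈ |R|≡3 with length≡2 (ℕP.suc-injective (trans (sym (length-remove D∈)) |R|≡3))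
  ... | a₁ , a₂ , R∖D≡ = a₁ , a₂ , record
    { D∈R    = D∈
    ; a₁∈R   = ∈-remove⁻ (∈R∖D (here refl))
    ; a₂∈R   = ∈-remove⁻ (∈R∖D (there (here refl)))
    ; a₁≢D   = ≢D (here refl)
    ; a₂≢D   = ≢D (there (here refl))
    ; a₁≢a₂  = a₁≢a₂
    ; others = λ a∈ a≢D → ∈-pair⁻ (subst (_ ∈_) R∖D≡ (∈-remove⁺ a∈ a≢D))
    ; ΣR≡    = trans (sumℤ-remove D∈) (trans (cong (λ l → D + sumℤ l) R∖D≡)
                                             (cong (λ s → D + (a₁ + s)) (ℤP.+-identityʳ a₂)))
    }
    where
    ∈R∖D : ∀ {a} → a ∈ a₁ ∷ a₂ ∷ [] → a ∈ remove D R
    ∈R∖D a∈ = subst (_ ∈_) (sym R∖D≡) a∈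
    ≢D : ∀ {a} → a ∈ a₁ ∷ a₂ ∷ [] → a ≢ D
    ≢D a∈ a≡D = ∉-remove uR (subst (_∈ remove D R) a≡D (∈R∖D a∈))
    a₁≢a₂ : a₁ ≢ a₂
    a₁≢a₂ with subst Unique R∖D≡ (Unique-remove uR)
    ... | (a₁≢a₂ ∷ []) ∷ _ = a₁≢a₂

  TripleWithD-swap : ∀ {R a₁ a₂} → TripleWithD R a₁ a₂ → TripleWithD R a₂ a₁
  TripleWithD-swap {a₁ = a₁} {a₂} T = record
    { D∈R    = D∈R
    ; a₁∈R   = a₂∈R
    ; a₂∈R   = a₁∈R
    ; a₁≢D   = a₂≢D
    ; a₂≢D   = a₁≢D
    ; a₁≢a₂  = λ a₂≡a₁ → a₁≢a₂ (sym a₂≡a₁)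
    ; others = λ a∈ a≢D → Data.Sum.swap (others a∈ a≢D)
    ; ΣR≡    = trans ΣR≡ (cong (D +_) (ℤP.+-comm a₁ a₂))
    }
    where open TripleWithD T

  chooseOne : ∀ {f R S a b} → Balanced f R S → TripleWithD R a b →
              f + a ≢ 0ℤ → f + a ≢ - D → (f + a ∈ S → b ≢ D + (f + a)) → UpMove f R S
  chooseOne {f} {R} {S} {a} {b} I T f+a≢0 f+a≢-D noPartner =
    (D ∷ b ∷ []) , s≤s (s≤s z≤n) , (a , a₁∈R , ∉-pair a₁≢D a₁≢a₂) , good
    where
    open TripleWithD T
    ΣR′≡ : sumℤ (remove a R) ≡ D + b
    ΣR′≡ = +-cancelˡ a (trans (sym (sumℤ-remove a₁∈R)) (trans ΣR≡ (solve D a b)))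
      where
      solve : ∀ D a b → D + (a + b) ≡ a + (D + b)
      solve = solve-∀
    ΣR′≢D : remove a R ≢ [] → sumℤ (remove a R) ≢ D
    ΣR′≢D _ ΣR′≡D = ℤP.<⇒≢ (All.lookup (0<R I) a₂∈R)
      (sym (+-cancelˡ D (trans (sym ΣR′≡) (trans ΣR′≡D (sym (ℤP.+-identityʳ D))))))
    good : ∀ {a′} → a′ ∈ R → a′ ∉ D ∷ b ∷ [] → Good (f + a′) (remove a′ R) S
    good a′∈ a′∉F with others a′∈ (λ a′≡D → a′∉F (here a′≡D))
    ... | inj₂ a′≡b = ⊥-elim (a′∉F (there (here a′≡b)))
    ... | inj₁ refl = inj₂ (live f+a≢0 ΣR′≢D (λ (f+a≡-D , _) → f+a≢-D f+a≡-D)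
      (λ dead@(_ , _ , _ , f+a∈S , _) → noPartner f+a∈S (dead₂⇒partner (Balanced-up I a₁∈R) dead ΣR′≡)))

  chooseD : ∀ {f R S a₁ a₂} → Balanced f R S → TripleWithD R a₁ a₂ → f ≢ - D → a₁ + a₂ ≢ D → UpMove f R S
  chooseD {f} {R} {S} {a₁} {a₂} I T f≢-D a₁+a₂≢D =
    (a₁ ∷ a₂ ∷ []) , s≤s (s≤s z≤n) , (D , D∈R , ∉-pair (λ D≡a₁ → a₁≢D (sym D≡a₁)) (λ D≡a₂ → a₂≢D (sym D≡a₂))) , good
    where
    open TripleWithD T
    D∉R′ : D ∉ remove D R
    D∉R′ = ∉-remove (uniqueR I)
    ΣR′≡ : sumℤ (remove D R) ≡ a₁ + a₂
    ΣR′≡ = +-cancelˡ D (trans (sym (sumℤ-remove D∈R)) ΣR≡)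
    good : ∀ {a} → a ∈ R → a ∉ a₁ ∷ a₂ ∷ [] → Good (f + a) (remove a R) S
    good {a} a∈ a∉F with a ℤ.≟ D
    ... | no a≢D   = ⊥-elim ([ (λ a≡a₁ → a∉F (here a≡a₁)) , (λ a≡a₂ → a∉F (there (here a≡a₂))) ]′ (others a∈ a≢D))
    ... | yes refl = inj₂ (live (λ f+D≡0 → f≢-D (neg-swap (+≡0⇒≡- f+D≡0)))
                                (λ _ ΣR′≡D → a₁+a₂≢D (trans (sym ΣR′≡) ΣR′≡D))
                                (λ (_ , D∈ , _) → D∉R′ D∈) (λ (D∈ , _) → D∉R′ D∈))

  noPartner : ∀ {f R S a₁ a₂} → Balanced f R S → TripleWithD R a₁ a₂ → a₁ + a₂ ≡ D →
              f + a₁ ∈ S → a₂ ≢ D + (f + a₁)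
  noPartner {f} {a₁ = a₁} {a₂} I T a₁+a₂≡D g∈ a₂≡D+g =
    ℤP.<⇒≢ (ℤP.+-mono-< (All.lookup (0<R I) a₁∈R) (All.lookup (0<S I) g∈)) (sym (begin
      a₁ + (f + a₁)                    ≡⟨ solve a₁ a₂ (f + a₁) ⟩
      a₁ + a₂ + (f + a₁) - a₂          ≡⟨ cong (λ d → d + (f + a₁) - a₂) a₁+a₂≡D ⟩
      D + (f + a₁) - a₂                ≡⟨ cong (_- a₂) (sym a₂≡D+g) ⟩
      a₂ - a₂                          ≡⟨ ℤP.+-inverseʳ a₂ ⟩
      0ℤ                               ∎))
    where
    open ≡-Reasoning
    open TripleWithD T
    solve : ∀ a₁ a₂ g → a₁ + g ≡ a₁ + a₂ + g - a₂
    solve = solve-∀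

  ¬opposite : ∀ {f u v} → 0ℤ < u → f + v ≡ 0ℤ → f + u ≢ - (u + v)
  ¬opposite {f} {u} {v} 0<u f+v≡0 f+u≡ = ℤP.<⇒≢ (ℤP.+-mono-< 0<u 0<u) (sym (begin
    u + u                                 ≡⟨ solve f u v ⟩
    (f + u) + (u + v) - (f + v)           ≡⟨ cong₂ (λ x y → x + (u + v) - y) f+u≡ f+v≡0 ⟩
    - (u + v) + (u + v) - 0ℤ              ≡⟨ cong (_- 0ℤ) (ℤP.+-inverseˡ (u + v)) ⟩
    0ℤ                                    ∎))
    where
    open ≡-Reasoning
    solve : ∀ f u v → u + u ≡ (f + u) + (u + v) - (f + v)
    solve = solve-∀

  -- With R = {D, a₁, a₂}, adding D is safe unless f = -D or a₁ + a₂ = D, and then a₁ or a₂ is.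
  upMove-triple : ∀ {f R S} → Balanced f R S → D ∈ R → length R ≡ 3 → UpMove f R S
  upMove-triple {f} I D∈ |R|≡3 with tripleWithD (uniqueR I) D∈ |R|≡3
  ... | a₁ , a₂ , T with f ℤ.≟ - D
  ...   | yes refl = chooseOne I T -D+a₁≢0 -D+a₁≢-D (λ _ a₂≡ → a₁≢a₂ (sym (trans a₂≡ (solve D a₁))))
    where
    open TripleWithD T
    solve : ∀ D a → D + (- D + a) ≡ a
    solve = solve-∀
    -D+a₁≢0 : - D + a₁ ≢ 0ℤ
    -D+a₁≢0 e = a₁≢D (trans (+≡0⇒≡- e) (ℤP.neg-involutive D))
    -D+a₁≢-D : - D + a₁ ≢ - D
    -D+a₁≢-D e = ℤP.<⇒≢ (All.lookup (0<R I) a₁∈R) (sym (+-cancelˡ (- D) (trans e (sym (ℤP.+-identityʳ (- D))))))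
  ...   | no f≢-D with a₁ + a₂ ℤ.≟ D
  ...     | no a₁+a₂≢D = chooseD I T f≢-D a₁+a₂≢D
  ...     | yes a₁+a₂≡D with (f + a₁ ℤ.≟ 0ℤ) ⊎-dec (f + a₁ ℤ.≟ - D)
  ...       | no ¬bad = chooseOne I T (λ e → ¬bad (inj₁ e)) (λ e → ¬bad (inj₂ e)) (noPartner I T a₁+a₂≡D)
  ...       | yes bad = chooseOne I T′ f+a₂≢0 f+a₂≢-D (noPartner I T′ a₂+a₁≡D)
    where
    open TripleWithD T
    T′ : TripleWithD _ a₂ a₁
    T′ = TripleWithD-swap T
    a₂+a₁≡D : a₂ + a₁ ≡ D
    a₂+a₁≡D = trans (ℤP.+-comm a₂ a₁) a₁+a₂≡D
    f+a₂≢0 : f + a₂ ≢ 0ℤ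
    f+a₂≢0 e₂ = [ (λ e₁ → a₁≢a₂ (+-cancelˡ f (trans e₁ (sym e₂))))
                , (λ e₁ → ¬opposite {f} (All.lookup (0<R I) a₁∈R) e₂ (trans e₁ (cong -_ (sym a₁+a₂≡D)))) ]′ bad
    f+a₂≢-D : f + a₂ ≢ - D
    f+a₂≢-D e₂ = [ (λ e₁ → ¬opposite {f} (All.lookup (0<R I) a₂∈R) e₁ (trans e₂ (cong -_ (sym a₂+a₁≡D))))
                 , (λ e₁ → a₁≢a₂ (+-cancelˡ f (trans e₁ (sym e₂)))) ]′ bad

  upMove : ∀ {f R S} → Balanced f R S → Live f R S → R ≢ [] → UpMove f R S
  upMove {R = []}                    _ _ R≢[] = ⊥-elim (R≢[] refl)
  upMove {R = _ ∷ []}                I _ _    = upMove-single I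
  upMove {R = _ ∷ _ ∷ []}            I L _    = upMove-pair I L
  upMove {R = R@(_ ∷ _ ∷ _ ∷ [])}    I _ _ with D ∈? R
  ... | no D∉  = upMove-generic I (s≤s (s≤s (s≤s z≤n))) (λ _ → D∉)
  ... | yes D∈ = upMove-triple I D∈ refl
  upMove {R = _ ∷ _ ∷ _ ∷ _ ∷ _}     I _ _    = upMove-generic I (s≤s (s≤s (s≤s z≤n))) (λ ())

  live-down : ∀ {f R S b} → Live f R S → f - b ≢ 0ℤ → ¬ (D ∈ R × length R ≡ 2) → Live (f - b) R (remove b S)
  live-down L f-b≢0 notPair =
    live f-b≢0 (ΣR≢D L) (λ (_ , D∈ , len) → notPair (D∈ , len)) (λ (D∈ , len , _) → notPair (D∈ , len))

  downMove-emptyR : ∀ {f S} → Balanced f [] S → S ≢ [] → DownMove f [] S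
  downMove-emptyR {S = []}    _ S≢[] = ⊥-elim (S≢[] refl)
  downMove-emptyR {S = b ∷ _} I _    =
    [] , z≤n , (b , here refl , λ ()) , λ b∈ _ → Good-emptyR (Balanced-down I b∈) refl

  downMove-generic : ∀ {f R S} → Balanced f R S → Live f R S → R ≢ [] → ¬ (D ∈ R × length R ≡ 2) →
                     S ≢ [] → DownMove f R S
  downMove-generic {S = []} _ _ _ _ S≢[] = ⊥-elim (S≢[] refl)
  downMove-generic {f} {R} {b ∷ []} I L R≢[] notPair _ = [] , z≤n , (b , here refl , λ ()) , good
    where
    good : ∀ {b′} → b′ ∈ b ∷ [] → b′ ∉ [] → Good (f - b′) R (remove b′ (b ∷ []))
    good {b′} b′∈ _ = inj₂ (live-down L f-b′≢0 notPair)
      where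
      solve : ∀ r → r ≡ 0ℤ + r - 0ℤ
      solve = solve-∀
      f-b′≢0 : f - b′ ≢ 0ℤ
      f-b′≢0 f-b′≡0 = ΣR≢D L R≢[] (trans (solve (sumℤ R))
        (trans (cong₂ (λ g l → g + sumℤ R - sumℤ l) (sym f-b′≡0) (sym (remove-single b′∈)))
               (balance (Balanced-down I b′∈))))
  downMove-generic {f} {R} {S@(_ ∷ _ ∷ _)} I L _ notPair _ =
    allButAtMost3-byCounting (f ∷ []) (uniqueS I) (s≤s (s≤s z≤n)) (s≤s z≤n)
      (λ b∈ b∉F → inj₂ (live-down L (λ f-b≡0 → b∉F (here (sym (ℤP.i-j≡0⇒i≡j f _ f-b≡0)))) notPair))

  live-down-pair : ∀ {f R S b} → Live f R S → b ≢ f → b ≢ f + D → ¬ DeadEnd₂ (f - b) R (remove b S) →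
                   Live (f - b) R (remove b S)
  live-down-pair {f} {b = b} L b≢f b≢f+D noDead₂ =
    live (λ f-b≡0 → b≢f (sym (ℤP.i-j≡0⇒i≡j f b f-b≡0))) (ΣR≢D L)
         (λ (f-b≡-D , _) → b≢f+D (trans (solve f b) (trans (cong (λ x → f - x) f-b≡-D) (solve′ f D)))) noDead₂
    where
    solve : ∀ f b → b ≡ f - (f - b)
    solve = solve-∀
    solve′ : ∀ f D → f - - D ≡ f + D
    solve′ = solve-∀

  -- In the remaining down moves R = {D, c}, so the balance reads ΣS = f + c.
  downMove-pair-single : ∀ {f R b c} → Live f R (b ∷ []) → b ≡ f + c → 0ℤ < c → c ≢ D →
                         DownMove f R (b ∷ [])
  downMove-pair-single {f} {b = b} {c} L b≡f+c 0<c c≢D = [] , z≤n , (b , here refl , λ ()) , good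
    where
    good : ∀ {b′} → b′ ∈ b ∷ [] → b′ ∉ [] → Good (f - b′) _ (remove b′ (b ∷ []))
    good (here refl) _ = inj₂ (live-down-pair L
      (λ b≡f → ℤP.<⇒≢ 0<c (sym (+-cancelˡ f (trans (sym b≡f+c) (trans b≡f (sym (ℤP.+-identityʳ f)))))))
      (λ b≡f+D → c≢D (+-cancelˡ f (trans (sym b≡f+c) b≡f+D)))
      (λ (_ , _ , |S′|≡2 , _) → length-remove-≢ {S = b ∷ []} (here refl) (λ ()) |S′|≡2))

  downMove-pair-two : ∀ {f R u v} → Balanced f R (u ∷ v ∷ []) → Live f R (u ∷ v ∷ []) → D ∈ R → length R ≡ 2 →
                      DownMove f R (u ∷ v ∷ [])
  downMove-pair-two {f} {R} {u} {v} I L D∈ |R|≡2 = F , s≤s (s≤s z≤n) , witness (u ∈? F) (v ∈? F) , good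
    where
    S F : List ℤ
    S = u ∷ v ∷ []
    F = f ∷ f + D ∷ []
    good : ∀ {b} → b ∈ S → b ∉ F → Good (f - b) R (remove b S)
    good b∈ b∉F = inj₂ (live-down-pair L (λ b≡f → b∉F (here b≡f)) (λ b≡f+D → b∉F (there (here b≡f+D)))
                                         (λ (_ , _ , |S′|≡2 , _) → length-remove-≢ b∈ (λ ()) |S′|≡2))
    witness : Dec (u ∈ F) → Dec (v ∈ F) → ∃ λ b → b ∈ S × b ∉ F
    witness (no u∉) _        = u , here refl , u∉
    witness (yes _) (no v∉)  = v , there (here refl) , v∉
    witness (yes u∈) (yes v∈) = ⊥-elim (¬dead₂ L (D∈ , |R|≡2 , refl , F⊆S (here refl) , F⊆S (there (here refl))))
      where
      u≢v : u ≢ v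
      u≢v with uniqueS I
      ... | (u≢v ∷ []) ∷ _ = u≢v
      F⊆S : F ⊆ S
      F⊆S {w} w∈F with ∈-pair⁻ u∈ | ∈-pair⁻ v∈ | ∈-pair⁻ w∈F
      ... | inj₁ refl | inj₁ refl | _         = ⊥-elim (u≢v refl)
      ... | inj₂ refl | inj₂ refl | _         = ⊥-elim (u≢v refl)
      ... | inj₁ refl | inj₂ refl | inj₁ refl = here refl
      ... | inj₁ refl | inj₂ refl | inj₂ refl = there (here refl)
      ... | inj₂ refl | inj₁ refl | inj₁ refl = there (here refl)
      ... | inj₂ refl | inj₁ refl | inj₂ refl = here refl

  -- With three terms left in S the third forbidden value β = f + D - c guards against DeadEnd₂; if all
  -- of S were forbidden, comparing sums would give β + β = 0, impossible whether or not β ∈ S.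
  downMove-pair-three : ∀ {f R b₁ b₂ b₃ c} → Balanced f R (b₁ ∷ b₂ ∷ b₃ ∷ []) → Live f R (b₁ ∷ b₂ ∷ b₃ ∷ []) →
                        sumℤ R ≡ D + c → sumℤ (b₁ ∷ b₂ ∷ b₃ ∷ []) ≡ f + c → DownMove f R (b₁ ∷ b₂ ∷ b₃ ∷ [])
  downMove-pair-three {f} {R} {b₁} {b₂} {b₃} {c} I L ΣR≡ ΣS≡ = F , ℕP.≤-refl , witness (all? (_∈? F) S) , good
    where
    β : ℤ
    β = f + D - c
    S F : List ℤ
    S = b₁ ∷ b₂ ∷ b₃ ∷ []
    F = f ∷ f + D ∷ β ∷ []
    good : ∀ {b} → b ∈ S → b ∉ F → Good (f - b) R (remove b S)
    good {b} b∈ b∉F = inj₂ (live-down-pair L (λ b≡f → b∉F (here b≡f)) (λ b≡f+D → b∉F (there (here b≡f+D)))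
      (λ dead → b∉F (there (there (here (b≡β (dead₂⇒partner (Balanced-down I b∈) dead ΣR≡)))))))
      where
      solve : ∀ f b D → b ≡ f + D - (D + (f - b))
      solve = solve-∀
      b≡β : c ≡ D + (f - b) → b ≡ β
      b≡β c≡ = trans (solve f b D) (cong (λ x → f + D - x) (sym c≡))
    witness : Dec (All (_∈ F) S) → ∃ λ b → b ∈ S × b ∉ F
    witness (no ¬all) = find (AllP.¬All⇒Any¬ (_∈? F) S ¬all)
    witness (yes all) = ⊥-elim (allForbidden (β ∈? S))
      where
      solve : ∀ f D c → (f + D - c) + (f + D - c) ≡ f + (f + D + ((f + D - c) + 0ℤ)) - (f + c)
      solve = solve-∀
      β+β≡0 : β + β ≡ 0ℤ
      β+β≡0 = trans (solve f D c)
        (trans (cong (_- (f + c)) (trans (sym (sumℤ-⊆-sameLength (uniqueS I) (All.lookup all) refl)) ΣS≡))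
               (ℤP.+-inverseʳ (f + c)))
      allForbidden : Dec (β ∈ S) → ⊥
      allForbidden (yes β∈) = ℤP.<⇒≢ (ℤP.+-mono-< 0<β 0<β) (sym β+β≡0)
        where
        0<β : 0ℤ < β
        0<β = All.lookup (0<S I) β∈
      allForbidden (no β∉) = ℕP.<-irrefl refl (Unique-⊆⇒length≤ (uniqueS I) S⊆F∖β)
        where
        S⊆F∖β : S ⊆ f ∷ f + D ∷ []
        S⊆F∖β w∈ with All.lookup all w∈
        ... | here w≡f                  = here w≡f
        ... | there (here w≡f+D)        = there (here w≡f+D)
        ... | there (there (here refl)) = ⊥-elim (β∉ w∈)

  downMove-pair-many : ∀ {f R S} → Balanced f R S → Live f R S → 4 ℕ.≤ length S → DownMove f R S
  downMove-pair-many {f} {R} {S} I L 4≤|S| =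
    allButAtMost3-byCounting (f ∷ f + D ∷ []) (uniqueS I) (ℕP.≤-trans (s≤s (s≤s (s≤s z≤n))) 4≤|S|) (s≤s (s≤s z≤n)) good
    where
    good : ∀ {b} → b ∈ S → b ∉ f ∷ f + D ∷ [] → Good (f - b) R (remove b S)
    good b∈ b∉F = inj₂ (live-down-pair L (λ b≡f → b∉F (here b≡f)) (λ b≡f+D → b∉F (there (here b≡f+D)))
      (λ (_ , _ , |S′|≡2 , _) → length-remove-≢ b∈ (λ |S|≡3 → ℕP.<-irrefl (sym |S|≡3) 4≤|S|) |S′|≡2))

  downMove-pair : ∀ {f R S} → Balanced f R S → Live f R S → D ∈ R → length R ≡ 2 → S ≢ [] → DownMove f R S
  downMove-pair {f} {R} {S} I L D∈ |R|≡2 S≢[] with pairWithD (uniqueR I) |R|≡2 D∈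
  ... | c , c∈ , c≢D , ΣR≡ = byLength S refl
    where
    solve : ∀ f D c s → s ≡ f + c - (f + (D + c) - s - D)
    solve = solve-∀
    ΣS≡ : sumℤ S ≡ f + c
    ΣS≡ = trans (solve f D c (sumℤ S))
      (trans (cong (λ d → f + c - (d - D)) (trans (cong (λ r → f + r - sumℤ S) (sym ΣR≡)) (balance I)))
             (trans (cong (λ d → f + c - d) (ℤP.+-inverseʳ D)) (ℤP.+-identityʳ (f + c))))
    byLength : ∀ S′ → S′ ≡ S → DownMove f R S
    byLength []                    refl = ⊥-elim (S≢[] refl)
    byLength (b ∷ [])              refl = downMove-pair-single L (trans (sym (ℤP.+-identityʳ b)) ΣS≡)
                                                             (All.lookup (0<R I) c∈) c≢D
    byLength (_ ∷ _ ∷ [])          refl = downMove-pair-two I L D∈ |R|≡2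
    byLength (_ ∷ _ ∷ _ ∷ [])      refl = downMove-pair-three I L ΣR≡ ΣS≡
    byLength (_ ∷ _ ∷ _ ∷ _ ∷ _)   refl = downMove-pair-many I L (s≤s (s≤s (s≤s (s≤s z≤n))))

  downMove : ∀ {f R S} → Balanced f R S → Live f R S → S ≢ [] → DownMove f R S
  downMove {R = []}          I _ S≢[] = downMove-emptyR I S≢[]
  downMove {R = R@(_ ∷ _)}   I L S≢[] with D ∈? R ×-dec length R ℕ.≟ 2
  ... | no notPair         = downMove-generic I L (λ ()) notPair S≢[]
  ... | yes (D∈ , |R|≡2)   = downMove-pair I L D∈ |R|≡2 S≢[]

-- The greedy walk

module _ (rank : ℤ → ℕ) (s : ℤ) where

  keyLe? : ∀ b a → Dec (KeyLe rank s b a)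
  keyLe? b a = (rank (s + b) ℕ.<? rank (s + a)) ⊎-dec ((rank (s + b) ℕ.≟ rank (s + a)) ×-dec (b ℤ.≤? a))

  keyLe-refl : ∀ {a} → KeyLe rank s a a
  keyLe-refl = inj₂ (refl , ℤP.≤-refl)

  keyLe-trans : ∀ {a b c} → KeyLe rank s a b → KeyLe rank s b c → KeyLe rank s a c
  keyLe-trans         (inj₁ a<b)        (inj₁ b<c)       = inj₁ (ℕP.<-trans a<b b<c)
  keyLe-trans {a}     (inj₁ a<b)        (inj₂ (b≡c , _)) = inj₁ (subst (rank (s + a) ℕ.<_) b≡c a<b)
  keyLe-trans {c = c} (inj₂ (a≡b , _))  (inj₁ b<c)       = inj₁ (subst (ℕ._< rank (s + c)) (sym a≡b) b<c)
  keyLe-trans         (inj₂ (a≡b , a≤b)) (inj₂ (b≡c , b≤c)) = inj₂ (trans a≡b b≡c , ℤP.≤-trans a≤b b≤c)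

  keyLe-flip : ∀ {a b} → ¬ KeyLe rank s a b → KeyLe rank s b a
  keyLe-flip {a} {b} a≰b with ℕP.<-cmp (rank (s + a)) (rank (s + b))
  ... | tri< a<b _ _ = ⊥-elim (a≰b (inj₁ a<b))
  ... | tri> _ _ b<a = inj₁ b<a
  ... | tri≈ _ a≡b _ with a ℤ.≤? b
  ...   | yes a≤b = ⊥-elim (a≰b (inj₂ (a≡b , a≤b)))
  ...   | no  a≰b′ = inj₂ (sym a≡b , ℤP.<⇒≤ (ℤP.≰⇒> a≰b′))

  greatest : ∀ C → C ≢ [] → ∃ λ a → a ∈ C × (∀ {b} → b ∈ C → KeyLe rank s b a)
  greatest []           C≢[] = ⊥-elim (C≢[] refl)
  greatest (x ∷ [])     _    = x , here refl , λ { (here refl) → keyLe-refl }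
  greatest (x ∷ y ∷ C)  _    with greatest (y ∷ C) (λ ())
  ... | a , a∈ , max with keyLe? x a
  ...   | yes x≤a = a , there a∈ , λ { (here refl) → x≤a ; (there b∈) → max b∈ }
  ...   | no  x≰a = x , here refl , λ { (here refl) → keyLe-refl ; (there b∈) → keyLe-trans (max b∈) (keyLe-flip x≰a) }

  pickGreedy : ∀ {C P} → AllButAtMost3 C P → ∃ λ a → a ∈ C × P a × GreedyChoice rank s a C
  pickGreedy {C} (F , |F|≤3 , (a₀ , a₀∈ , a₀∉) , good) with greatest (filter (∁? (_∈? F)) C) nonEmpty
    where
    nonEmpty : filter (∁? (_∈? F)) C ≢ []
    nonEmpty C∖F≡[] with subst (a₀ ∈_) C∖F≡[] (∈-filter⁺ (∁? (_∈? F)) a₀∈ a₀∉)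
    ... | ()
  ... | a , a∈C∖F , max with ∈-filter⁻ (∁? (_∈? F)) {xs = C} a∈C∖F
  ...   | a∈ , a∉ = a , a∈ , good a∈ a∉ , (F , |F|≤3 , λ b∈ b∉ → max (∈-filter⁺ (∁? (_∈? F)) b∈ b∉))

GreedyChoice-↭ : ∀ {rank s a xs ys} → xs ↭ ys → GreedyChoice rank s a xs → GreedyChoice rank s a ys
GreedyChoice-↭ xs↭ys (F , |F|≤3 , max) = F , |F|≤3 , λ b∈ → max (PermP.∈-resp-↭ (↭-sym xs↭ys) b∈)

Arrangement : (rankP rankN : ℤ → ℕ) → ℤ → List ℤ → List ℤ → ℤ → ℤ → Set
Arrangement rankP rankN f R S sP sN =
  ∃₂ λ ps ns → ps ↭ R × ns ↭ S × Walk f ps ns × GreedyOrder rankP sP ps × GreedyOrder rankN sN ns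

module Build (D : ℤ) (0≤D : 0ℤ ≤ D) (rankP rankN : ℤ → ℕ) where

  open Moves D 0≤D

  direction : ∀ f (R S : List ℤ) → f ≢ 0ℤ → 0 ℕ.< length R ℕ.+ length S →
              (R ≢ [] × (f < 0ℤ ⊎ S ≡ [])) ⊎ (S ≢ [] × (0ℤ < f ⊎ R ≡ []))
  direction f []      []      _   ()
  direction f []      (_ ∷ _) _   _ = inj₂ ((λ ()) , inj₂ refl)
  direction f (_ ∷ _) []      _   _ = inj₁ ((λ ()) , inj₂ refl)
  direction f (_ ∷ _) (_ ∷ _) f≢0 _ with ℤP.<-cmp f 0ℤ
  ... | tri< f<0 _ _ = inj₁ ((λ ()) , inj₁ f<0)
  ... | tri≈ _ f≡0 _ = ⊥-elim (f≢0 f≡0)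
  ... | tri> _ _ 0<f = inj₂ ((λ ()) , inj₁ 0<f)

  arrange : ∀ n {f R S} sP sN → length R ℕ.+ length S ≡ n → Balanced f R S → Good f R S →
            Arrangement rankP rankN f R S sP sN
  arrange zero    {R = []}    {[]}    _  _  _   _ _ = [] , [] , ↭-refl , ↭-refl , done , tt , tt
  arrange (suc n) {R = []}    {[]}    _  _  ()  _ _
  arrange (suc n) {f} {R} {S} sP sN len I (inj₂ L) =
    [ stepUp , stepDown ]′ (direction f R S (f≢0 L) (subst (0 ℕ.<_) (sym len) (s≤s z≤n)))
    where
    stepUp : R ≢ [] × (f < 0ℤ ⊎ S ≡ []) → Arrangement rankP rankN f R S sP sN
    stepUp (R≢[] , side) =
      let a , a∈ , good , choice = pickGreedy rankP sP (upMove I L R≢[])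
          len′ = ℕP.suc-injective (trans (cong (ℕ._+ length S) (sym (length-remove a∈))) len)
          ps , ns , ps↭ , ns↭ , w , orderP , orderN = arrange n (sP + a) sN len′ (Balanced-up I a∈) good
          a∷ps↭R = ↭-trans (prep a ps↭) (↭-sym (remove-↭ a∈))
      in a ∷ ps , ns , a∷ps↭R , ns↭ ,
         up (f≢0 L) (Data.Sum.map id (λ { refl → PermP.↭-empty-inv ns↭ }) side) w ,
         (GreedyChoice-↭ {rankP} {sP} (↭-sym a∷ps↭R) choice , orderP) , orderN
    stepDown : S ≢ [] × (0ℤ < f ⊎ R ≡ []) → Arrangement rankP rankN f R S sP sN
    stepDown (S≢[] , side) =
      let b , b∈ , good , choice = pickGreedy rankN sN (downMove I L S≢[])
          len′ = ℕP.suc-injective (trans (sym (ℕP.+-suc (length R) _))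
                                         (trans (cong (length R ℕ.+_) (sym (length-remove b∈))) len))
          ps , ns , ps↭ , ns↭ , w , orderP , orderN = arrange n sP (sN + b) len′ (Balanced-down I b∈) good
          b∷ns↭S = ↭-trans (prep b ns↭) (↭-sym (remove-↭ b∈))
      in ps , b ∷ ns , ps↭ , b∷ns↭S ,
         down (f≢0 L) (Data.Sum.map id (λ { refl → PermP.↭-empty-inv ps↭ }) side) w ,
         orderP , (GreedyChoice-↭ {rankN} {sN} (↭-sym b∷ns↭S) choice , orderN)

greedyWalk-D≥0 : ∀ rankP rankN δ {P N} → Unique P → Unique N → All (0ℤ <_) P → All (0ℤ <_) N →
  0ℤ < δ → δ ∉ N → (P ≢ [] → δ ≢ sumℤ N) → 0ℤ ≤ δ + sumℤ P - sumℤ N → Arrangement rankP rankN δ P N 0ℤ 0ℤ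
greedyWalk-D≥0 rankP rankN δ {P} {N} uP uN 0<P 0<N 0<δ δ∉N δ≢ΣN 0≤D =
  Build.arrange D 0≤D rankP rankN _ 0ℤ 0ℤ refl (balanced uP uN 0<P 0<N refl)
    (inj₂ (live (λ δ≡0 → ℤP.<⇒≢ 0<δ (sym δ≡0)) ΣP≢D notDead₁ (λ (_ , _ , _ , δ∈N , _) → δ∉N δ∈N)))
  where
  D : ℤ
  D = δ + sumℤ P - sumℤ N
  open Moves D 0≤D
  solve : ∀ d p n → d ≡ d + p - n - p + n
  solve = solve-∀
  ΣP≢D : P ≢ [] → sumℤ P ≢ D
  ΣP≢D P≢[] ΣP≡D = δ≢ΣN P≢[] (trans (solve δ (sumℤ P) (sumℤ N))
    (trans (cong (λ x → x - sumℤ P + sumℤ N) (sym ΣP≡D)) (trans (cong (_+ sumℤ N) (ℤP.+-inverseʳ (sumℤ P)))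
                                                               (ℤP.+-identityˡ (sumℤ N)))))
  notDead₁ : ¬ DeadEnd₁ δ P
  notDead₁ (δ≡-D , _) = ℤP.<⇒≢ (ℤP.≤-<-trans (ℤP.neg-mono-≤ 0≤D) 0<δ) (sym δ≡-D)

greedyWalk-D<0 : ∀ rankP rankN δ {P N} → Unique P → Unique N → All (0ℤ <_) P → All (0ℤ <_) N →
  0ℤ < δ → δ ∉ N → δ + sumℤ P - sumℤ N < 0ℤ → Arrangement rankN rankP (- δ) N P 0ℤ 0ℤ
greedyWalk-D<0 rankP rankN δ {P} {N} uP uN 0<P 0<N 0<δ δ∉N D<0 =
  Build.arrange (- D) 0≤-D rankN rankP _ 0ℤ 0ℤ refl (balanced uN uP 0<N 0<P (solve δ (sumℤ P) (sumℤ N)))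
    (inj₂ (live (λ -δ≡0 → ℤP.<⇒≢ 0<δ (sym (neg-swap (sym -δ≡0)))) ΣN≢-D notDead₁ (λ (_ , _ , _ , -δ∈P , _) → -δ∉P -δ∈P)))
  where
  D : ℤ
  D = δ + sumℤ P - sumℤ N
  0≤-D : 0ℤ ≤ - D
  0≤-D = ℤP.<⇒≤ (ℤP.neg-mono-< D<0)
  open Moves (- D) 0≤-D
  solve : ∀ d p n → - d + n - p ≡ - (d + p - n)
  solve = solve-∀
  solve′ : ∀ d p n → d + p ≡ n - (- (d + p - n))
  solve′ = solve-∀
  ΣN≢-D : N ≢ [] → sumℤ N ≢ - D
  ΣN≢-D _ ΣN≡-D = ℤP.<⇒≢ (ℤP.<-≤-trans 0<δ (subst (_≤ δ + sumℤ P) (ℤP.+-identityʳ δ) (ℤP.+-monoʳ-≤ δ (sumℤ-nonneg 0<P))))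
    (sym (trans (solve′ δ (sumℤ P) (sumℤ N)) (trans (cong (λ x → sumℤ N - x) (sym ΣN≡-D)) (ℤP.+-inverseʳ (sumℤ N)))))
  notDead₁ : ¬ DeadEnd₁ (- δ) N
  notDead₁ (-δ≡-D′ , -D∈N , _) = δ∉N (subst (_∈ N) (sym (ℤP.neg-injective -δ≡-D′)) -D∈N)
  -δ∉P : - δ ∉ P
  -δ∉P -δ∈P = ℤP.<⇒≢ (ℤP.<-trans (ℤP.neg-mono-< 0<δ) (All.lookup 0<P -δ∈P)) refl

greedyWalk : ∀ rankP rankN δ {P N} → Unique P → Unique N → All (0ℤ <_) P → All (0ℤ <_) N →
  0ℤ < δ → δ ∉ N → (P ≢ [] → δ ≢ sumℤ N) → Arrangement rankP rankN δ P N 0ℤ 0ℤ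
greedyWalk rankP rankN δ {P} {N} uP uN 0<P 0<N 0<δ δ∉N δ≢ΣN with 0ℤ ℤ.≤? δ + sumℤ P - sumℤ N
... | yes 0≤D = greedyWalk-D≥0 rankP rankN δ uP uN 0<P 0<N 0<δ δ∉N δ≢ΣN 0≤D
... | no  D≱0 with greedyWalk-D<0 rankP rankN δ uP uN 0<P 0<N 0<δ δ∉N (ℤP.≰⇒> D≱0)
...   | ns , ps , ns↭ , ps↭ , w , orderN , orderP =
  ps , ns , ps↭ , ns↭ , subst (λ g → Walk g ps ns) (ℤP.neg-involutive δ) (mirror w) , orderP , orderN

map-neg-involutive : ∀ (xs : List ℤ) → map -_ (map -_ xs) ≡ xs
map-neg-involutive []       = refl
map-neg-involutive (x ∷ xs) = cong₂ _∷_ (ℤP.neg-involutive x) (map-neg-involutive xs)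

IS-map-neg : ∀ q → IS (map -_ q) ≡ map -_ (IS q)
IS-map-neg []      = refl
IS-map-neg (a ∷ q) = cong (0ℤ ∷_) (begin
  map (λ x → - a + x) (IS (map -_ q))   ≡⟨ cong (map (λ x → - a + x)) (IS-map-neg q) ⟩
  map (λ x → - a + x) (map -_ (IS q))   ≡⟨ LP.map-∘ (IS q) ⟨
  map (λ x → - a + - x) (IS q)          ≡⟨ LP.map-cong (λ x → sym (ℤP.neg-distrib-+ a x)) (IS q) ⟩
  map (λ x → - (a + x)) (IS q)          ≡⟨ LP.map-∘ (IS q) ⟩
  map -_ (map (λ x → a + x) (IS q))     ∎)
  where open ≡-Reasoning

countIn-map-neg : ∀ {Y} → Unique Y → ∀ S → countIn Y (map -_ S) ℕ.≤ countIn (map -_ Y) S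
countIn-map-neg {Y} uY S = begin
  length (filter (_∈? map -_ S) Y)           ≡⟨ LP.length-map -_ (filter (_∈? map -_ S) Y) ⟨
  length (map -_ (filter (_∈? map -_ S) Y))  ≤⟨ Unique-⊆⇒length≤ unique negated ⟩
  countIn (map -_ Y) S                       ∎
  where
  open ℕP.≤-Reasoning
  unique : Unique (map -_ (filter (_∈? map -_ S) Y))
  unique = UniqueP.map⁺ ℤP.neg-injective (UniqueP.filter⁺ (_∈? map -_ S) uY)
  negated : map -_ (filter (_∈? map -_ S) Y) ⊆ filter (_∈? S) (map -_ Y)
  negated w∈ with ∈-map⁻ -_ w∈
  ... | y , y∈ , refl with ∈-filter⁻ (_∈? map -_ S) {xs = Y} y∈
  ...   | y∈Y , y∈-S with ∈-map⁻ -_ y∈-S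
  ...     | s , s∈S , refl = ∈-filter⁺ (_∈? S) (∈-map⁺ -_ y∈Y) (subst (_∈ S) (sym (ℤP.neg-involutive s)) s∈S)

sumBefore-map : ∀ {m} (f : ℤ → ℤ) (Y : Fin m → List ℤ) j → sumBefore (λ i → map f (Y i)) j ≡ sumBefore Y j
sumBefore-map {m} f Y j =
  cong sumℕ (LP.map-cong (λ i → LP.length-map f (Y i)) (filter (λ i → toℕ i ℕ.<? toℕ j) (allFin m)))

BoundedByInf-mono : ∀ {c′ c y S} → c′ ℕ.≤ c → BoundedByInf c y S → BoundedByInf c′ y S
BoundedByInf-mono c′≤c bound L 1≤L = ℕP.≤-trans (ℕP.*-monoˡ-≤ L c′≤c) (bound L 1≤L)

greedy⇒BoundedByInf-neg : ∀ {m} (Y : Fin m → List ℤ) → (∀ j → Unique (Y j)) →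
  ∀ q → Unique q → All (0ℤ <_) q → GreedyOrder (level (λ i → map -_ (Y i))) 0ℤ q →
  ∀ j → BoundedByInf (countIn (Y j) (IS (map -_ q))) (length (Y j)) (sumBefore Y j)
greedy⇒BoundedByInf-neg Y uY q uq 0<q order j =
  BoundedByInf-mono {S = sumBefore Y j} count≤
    (subst₂ (BoundedByInf (countIn (map -_ (Y j)) (IS q))) (LP.length-map -_ (Y j)) (sumBefore-map -_ Y j)
      (greedy⇒BoundedByInf (λ i → map -_ (Y i)) (λ i → UniqueP.map⁺ ℤP.neg-injective (uY i)) q uq 0<q order j))
  where
  count≤ : countIn (Y j) (IS (map -_ q)) ℕ.≤ countIn (map -_ (Y j)) (IS q)
  count≤ = subst (λ S → countIn (Y j) S ℕ.≤ countIn (map -_ (Y j)) (IS q)) (sym (IS-map-neg q))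
                 (countIn-map-neg (uY j) (IS q))

proposition4p1 : (P N : List ℤ) → Unique P → Unique N →
    All (λ x → 0ℤ < x) P → All (λ x → x < 0ℤ) N →
    (δ : ℕ) → 1 ℕ.≤ δ → (ℤ.+ δ) ∉ Data.List.map -_ N →
    (P ≢ [] → ℤ.+ δ ≢ - sumℤ N) →
    (m : ℕ) → 1 ℕ.≤ m →
    (Yp Yn : Fin m → List ℤ) → (∀ j → Unique (Yp j)) → (∀ j → Unique (Yn j)) →
    ∃₂ λ (p n : List ℤ) → (p ↭ P) × (n ↭ N) ×
      TwoSidedValid (reverse p ++ (ℤ.+ δ ∷ n)) ×
      (∀ (j : Fin m) →
        BoundedByInf (countIn (Yp j) (IS p)) (length (Yp j)) (sumBefore Yp j) ×
        BoundedByInf (countIn (Yn j) (IS n)) (length (Yn j)) (sumBefore Yn j))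
-- The bounds hold for every m.
proposition4p1 P N uP uN 0<P N<0 δ 1≤δ δ∉-N δ≢-ΣN m _ Yp Yn uYp uYn =
  let ps , ns , ps↭P , ns↭-N , w , orderP , orderN =
        greedyWalk (level Yp) (level (λ i → map -_ (Yn i))) (ℤ.+ δ) uP u-N 0<P 0<-N (ℤ.+<+ 1≤δ) δ∉-N δ≢Σ-N
      0<ps = PermP.All-resp-↭ (↭-sym ps↭P) 0<P
      0<ns = PermP.All-resp-↭ (↭-sym ns↭-N) 0<-N
  in ps , map -_ ns , ps↭P , subst (map -_ ns ↭_) (map-neg-involutive N) (PermP.map⁺ -_ ns↭-N) ,
     walk⇒TwoSidedValid 0<ps 0<ns w ,
     λ j → greedy⇒BoundedByInf Yp uYp ps (Unique-↭ (↭-sym ps↭P) uP) 0<ps orderP j ,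
           greedy⇒BoundedByInf-neg Yn uYn ns (Unique-↭ (↭-sym ns↭-N) u-N) 0<ns orderN j
  where
  u-N : Unique (map -_ N)
  u-N = UniqueP.map⁺ ℤP.neg-injective uN
  0<-N : All (0ℤ <_) (map -_ N)
  0<-N = AllP.map⁺ (All.map ℤP.neg-mono-< N<0)
  δ≢Σ-N : P ≢ [] → ℤ.+ δ ≢ sumℤ (map -_ N)
  δ≢Σ-N P≢[] δ≡ = δ≢-ΣN P≢[] (trans δ≡ (sumℤ-map-neg N))
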